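{- Let $p>3$ be a prime and $N\in\mathbf{F}_p^\times$, and let $$\mathcal{S}(N)=\Big\{(u,a)\in \mathbf{F}_p^\times \times(\mathbf{F}_p^\times\setminus\{ 1\}):\ u \ne a,\ u\ne a^{ -1},\ (ua-1)^{ -1}(ua^{ -1}-1)(a-1)^2= N\Big\}.$$ Then $$|\mathcal{S}(N)|=\begin{cases} p-5 & \text{if } N=1,\\ 2p-7 & \text{if } N=4,\\ p-7 & \text{if } N \text{ is a nonzero square in } \mathbf{F}_p \text{ and } N\ne 1,4,\\ p-3 & \text{if } N \text{ is a non-square in } \mathbf{F}_p. \end{cases}$$
   Context: All computations are in the field $\mathbf{F}_p$; $x^{ -1}$ denotes the multiplicative inverse of a nonzero $x$. -}

module Defs where

open import Data.Nat using (ℕ; zero; suc; _+_; _*_; _∸_; _^_; _<_; NonZero)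
open import Data.Nat.DivMod using (_%_)
open import Data.Nat.Properties using (_≟_)
open import Data.Fin using (Fin; toℕ)
open import Data.Fin.Subset using (Subset; ⁅_⁆)
open import Data.Product using (_×_; _,_; Σ; ∃)
open import Data.List using (List; filter; length; allFin; cartesianProduct)
open import Relation.Binary.PropositionalEquality using (_≡_; _≢_)
open import Relation.Nullary using (¬_; Dec)
open import Relation.Nullary.Decidable using (_×-dec_; ¬?)

-- Elements of F_p are represented by Fin p (residues 0..p-1);
-- arithmetic is done in ℕ and reduced mod p.
module Fp (p : ℕ) .{{_ : NonZero p}} where

  F : Set
  F = Fin p

  infixl 6 _⊕_ _⊖_
  infixl 7 _⊗_
  _⊕_ : ℕ → ℕ → ℕ
  x ⊕ y = (x + y) % p
  _⊗_ : ℕ → ℕ → ℕ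
  x ⊗ y = (x * y) % p
  _⊖_ : ℕ → ℕ → ℕ
  x ⊖ y = (x + (p ∸ (y % p))) % p

  -- multiplicative inverse in F_p (p prime): x⁻¹ = x^(p-2)  (Fermat)
  inv : ℕ → ℕ
  inv x = (x ^ (p ∸ 2)) % p

  IsNonzeroSquare : ℕ → Set
  IsNonzeroSquare N = (N % p ≢ 0) × ∃ λ (x : Fin p) → toℕ x ⊗ toℕ x ≡ N % p

  InS : ℕ → F × F → Set
  InS N (u , a) =
    (toℕ u ≢ 0) × (toℕ a ≢ 0) × (toℕ a ≢ 1) ×
    (toℕ u ≢ toℕ a) × (toℕ u ≢ inv (toℕ a)) ×
    (inv ((toℕ u ⊗ toℕ a) ⊖ 1) ⊗ ((toℕ u ⊗ inv (toℕ a)) ⊖ 1)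
       ⊗ ((toℕ a ⊖ 1) ⊗ (toℕ a ⊖ 1)) ≡ N % p)

  InS? : (N : ℕ) → (x : F × F) → Dec (InS N x)
  InS? N (u , a) =
    ¬? (toℕ u ≟ 0) ×-dec ¬? (toℕ a ≟ 0) ×-dec ¬? (toℕ a ≟ 1) ×-dec
    ¬? (toℕ u ≟ toℕ a) ×-dec ¬? (toℕ u ≟ inv (toℕ a)) ×-dec
    (_ ≟ _)

  cardS : ℕ → ℕ
  cardS N = length (filter (InS? N) (cartesianProduct (allFin p) (allFin p)))

module Submission where

-- F_p is modelled by ℤ with congruence modulo p; Fermat's little theorem
-- (proved via the binomial theorem) makes x^(p-2), the inverse used in
-- Defs, a genuine inverse.  Clearing denominators, the defining equation
-- becomes linear in u:   u K(a) = a Q(a),  ua ≠ 1,  where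
--   Q(a) = (a - 1)² - N   and   K(a) = (a - 1)² - N a².
-- Hence every a outside the "degenerate" set {0, 1, -1} ∪ Z(Q) ∪ Z(K)
-- contributes exactly one u; a degenerate a contributes none, except
-- a = -1 when N = 4, which contributes every u ∉ {0, -1}.  So
--   |S(N)| = p - #degenerate + [N = 4] (p - 2).
-- The degenerate set is {0, 1, -1} for N a non-square; for N = S² the
-- roots of Q are 1 ± S and those of K are (1 ∓ S)⁻¹, giving 5 values for
-- N = 1 and N = 4 and 7 distinct values otherwise.

open import Data.Nat using (ℕ; _<_)
open import Data.Nat.DivMod using (_%_)
open import Data.Nat.Primality using (Prime; prime⇒nonZero)
open import Data.Integer using (ℤ; 0ℤ)
open import Relation.Binary.PropositionalEquality using (_≡_; _≢_)

-- Fermat's little theorem x^p ≡ x (mod p) in ℕ, from the binomial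
-- theorem and the divisibility of the inner binomial coefficients by p.
module Fermat where
  open import Data.Nat
  open import Data.Nat.Properties
  open import Data.Nat.Divisibility
  open import Data.Nat.DivMod using (m/n*n≡m)
  open import Data.Nat.Primality
  open import Data.Nat.Combinatorics using (_C_; nCk≡n!/k![n-k]!; k![n∸k]!∣n!; nCn≡1)
  open import Data.Fin using (Fin; zero; suc; toℕ; fromℕ)
  open import Data.Fin.Properties using (toℕ-fromℕ)
  open import Data.Product using (∃; _,_; proj₁; proj₂)
  open import Data.Sum using (inj₁; inj₂)
  open import Data.Empty using (⊥-elim)
  open import Function using (_∘_)
  open import Relation.Nullary using (¬_)
  open import Relation.Binary.PropositionalEquality
  open import Data.Nat.Tactic.RingSolver using (solve-∀)
  open import Algebra.Properties.Monoid.Sum +-0-monoid using (sum)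
  import Algebra.Properties.CommutativeSemiring.Binomial +-*-commutativeSemiring as Binomial
  import Algebra.Properties.Semiring.Exp +-*-semiring as SemiringExp
  import Algebra.Properties.Semiring.Mult +-*-semiring as SemiringMult

  -- A prime p does not divide m! for m < p (Euclid's lemma on each factor).
  prime∤! : ∀ {p} → Prime p → ∀ m → m < p → ¬ (p ∣ m !)
  prime∤! pr zero m<p p∣1 = <⇒≢ (nonTrivial⇒n>1 _ ⦃ prime⇒nonTrivial pr ⦄) (sym (∣1⇒≡1 p∣1))
  prime∤! pr (suc m) m<p p∣m! with euclidsLemma (suc m) (m !) pr p∣m!
  ... | inj₁ p∣1+m = <⇒≱ m<p (∣⇒≤ p∣1+m)
  ... | inj₂ p∣m!  = prime∤! pr m (<-trans (n<1+n m) m<p) p∣m!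

  n∣n! : ∀ n → .{{NonZero n}} → n ∣ n !
  n∣n! (suc n) = m∣m*n (n !)

  -- p divides the binomial coefficients (p C k) with 0 < k < p:
  -- (p C k) * (k! (p-k)!) = p!, and p divides neither k! nor (p-k)!.
  prime∣C : ∀ {p} → Prime p → ∀ k → 0 < k → k < p → p ∣ p C k
  prime∣C {p} pr k 0<k k<p with euclidsLemma (p C k) (k ! * (p ∸ k) !) pr p∣C*k![p-k]!
    where
    instance _ = k !* (p ∸ k) !≢0
    instance _ = prime⇒nonZero pr
    p∣C*k![p-k]! : p ∣ (p C k) * (k ! * (p ∸ k) !)
    p∣C*k![p-k]! = subst (p ∣_)
      (sym (trans (cong (_* (k ! * (p ∸ k) !)) (nCk≡n!/k![n-k]! (<⇒≤ k<p))) (m/n*n≡m (k![n∸k]!∣n! (<⇒≤ k<p)))))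
      (n∣n! p)
  ... | inj₁ p∣C = p∣C
  ... | inj₂ p∣k![p-k]! with euclidsLemma (k !) ((p ∸ k) !) pr p∣k![p-k]!
  ...   | inj₁ p∣k!     = ⊥-elim (prime∤! pr k k<p p∣k!)
  ...   | inj₂ p∣[p-k]! = ⊥-elim (prime∤! pr (p ∸ k) (∸-monoʳ-< 0<k (<⇒≤ k<p)) p∣[p-k]!)

  -- The powers and multiples used by the generic binomial theorem are those of ℕ.
  ^-agrees : ∀ x n → x SemiringExp.^ n ≡ x ^ n
  ^-agrees x zero    = refl
  ^-agrees x (suc n) = cong (x *_) (^-agrees x n)

  ×-agrees : ∀ n x → n SemiringMult.× x ≡ n * x
  ×-agrees zero    x = refl
  ×-agrees (suc n) x = cong (x +_) (×-agrees n x)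

  sum-multiples+last : ∀ p q (g : Fin (suc q) → ℕ) → (∀ k → toℕ k < q → p ∣ g k) →
                       ∃ λ m → sum g ≡ m * p + g (fromℕ q)
  sum-multiples+last p zero    g p∣g = 0 , +-identityʳ (g zero)
  sum-multiples+last p (suc q) g p∣g
    with p∣g zero (s≤s z≤n) | sum-multiples+last p q (λ k → g (suc k)) (λ k k<q → p∣g (suc k) (s≤s k<q))
  ... | divides a g0≡ap | m , sum≡ = a + m , (begin
    g zero + sum (λ k → g (suc k))     ≡⟨ cong₂ _+_ g0≡ap sum≡ ⟩
    a * p + (m * p + last)             ≡⟨ regroup a m p last ⟩
    (a + m) * p + last                 ∎)
    where
    open ≡-Reasoning
    last = g (suc (fromℕ q))
    regroup : ∀ a m p z → a * p + (m * p + z) ≡ (a + m) * p + z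
    regroup = solve-∀

  -- Freshman's dream: (x + 1)^p ≡ x^p + 1 modulo p, since the inner
  -- binomial coefficients are divisible by p.
  freshman's-dream : ∀ {p} → Prime p → ∀ x → ∃ λ m → (x + 1) ^ p ≡ x ^ p + 1 + m * p
  freshman's-dream {zero}  pr x = ⊥-elim (≢-nonZero⁻¹ 0 ⦃ prime⇒nonZero pr ⦄ refl)
  freshman's-dream {suc q} pr x = m , (begin
    (x + 1) ^ p                             ≡⟨ sym (^-agrees (x + 1) p) ⟩
    (x + 1) SemiringExp.^ p                 ≡⟨ Binomial.theorem p x 1 ⟩
    term zero + sum (term ∘ suc)            ≡⟨ cong₂ _+_ first-term inner≡ ⟩
    1 + (m * p + term (suc (fromℕ q)))      ≡⟨ cong (λ z → 1 + (m * p + z)) last-term ⟩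
    1 + (m * p + x ^ p)                     ≡⟨ regroup m p (x ^ p) ⟩
    x ^ p + 1 + m * p                       ∎)
    where
    open ≡-Reasoning
    p = suc q
    term : Fin (suc p) → ℕ
    term = Binomial.binomialTerm x 1 p
    inner-divisible : ∀ k → toℕ k < q → p ∣ term (suc k)
    inner-divisible k k<q = subst (p ∣_) (sym (×-agrees (p C suc (toℕ k)) _))
      (∣-trans (prime∣C pr (suc (toℕ k)) (s≤s z≤n) (s≤s k<q)) (m∣m*n _))
    m = proj₁ (sum-multiples+last p q (term ∘ suc) inner-divisible)
    inner≡ : sum (term ∘ suc) ≡ m * p + term (suc (fromℕ q))
    inner≡ = proj₂ (sum-multiples+last p q (term ∘ suc) inner-divisible)
    first-term : term zero ≡ 1
    first-term = trans (×-agrees 1 _)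
      (trans (*-identityˡ _) (trans (*-identityˡ _) (trans (^-agrees 1 p) (^-zeroˡ p))))
    last-term : term (suc (fromℕ q)) ≡ x ^ p
    last-term rewrite toℕ-fromℕ q | nCn≡1 p | n∸n≡0 q =
      trans (+-identityʳ _) (trans (*-identityʳ _) (^-agrees x p))
    regroup : ∀ m p z → 1 + (m * p + z) ≡ z + 1 + m * p
    regroup = solve-∀

  fermat : ∀ {p} → Prime p → ∀ x → ∃ λ m → x ^ p ≡ x + m * p
  fermat {zero}  pr x    = ⊥-elim (≢-nonZero⁻¹ 0 ⦃ prime⇒nonZero pr ⦄ refl)
  fermat {suc q} pr zero = 0 , refl
  fermat {suc q} pr (suc x) with freshman's-dream pr x | fermat pr x
  ... | m₁ , dream | m₀ , ih = m₀ + m₁ , (begin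
    suc x ^ p                       ≡⟨ cong (_^ p) (+-comm 1 x) ⟩
    (x + 1) ^ p                     ≡⟨ dream ⟩
    x ^ p + 1 + m₁ * p              ≡⟨ cong (λ z → z + 1 + m₁ * p) ih ⟩
    x + m₀ * p + 1 + m₁ * p         ≡⟨ regroup x m₀ m₁ p ⟩
    suc x + (m₀ + m₁) * p           ∎)
    where
    open ≡-Reasoning
    p = suc q
    regroup : ∀ x a b p → x + a * p + 1 + b * p ≡ suc x + (a + b) * p
    regroup = solve-∀

-- Congruence modulo a prime p on ℤ, i.e. the arithmetic of the field F_p,
-- and its dictionary with the ℕ-level operations of Defs.
module Congruence (p : ℕ) (pr : Prime p) where
  open import Data.Nat as ℕ using (ℕ; zero; suc; NonZero)
  open import Data.Nat.Primality using (Prime; prime⇒nonZero; prime⇒nonTrivial; euclidsLemma)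
  import Data.Nat.Properties as ℕP
  open import Data.Nat.Divisibility using (divides; _∣_)
  open import Data.Nat.DivMod using (_%_; _/_; m≡m%n+[m/n]*n; [m+kn]%n≡m%n; m<n⇒m%n≡m; m%n<n)
  open import Data.Integer using (ℤ; +_; -[1+_]; _+_; _*_; _-_; -_; _^_; ∣_∣; 0ℤ; 1ℤ)
  import Data.Integer.Properties as ℤP
  open import Data.Integer.DivMod using (_%ℕ_; _/ℕ_; n%ℕd<d; a≡a%ℕn+[a/ℕn]*n)
  open import Data.Integer.Tactic.RingSolver using (solve-∀)
  open import Data.Product using (proj₁; proj₂)
  open import Data.Sum using (_⊎_; inj₁; inj₂; [_,_]′)
  open import Data.Empty using (⊥-elim)
  open import Relation.Nullary using (¬_)
  open import Function using (_⇔_; mk⇔)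
  open import Relation.Binary.PropositionalEquality
  open import Relation.Binary.Bundles using (Setoid)
  import Relation.Binary.Reasoning.Setoid as SetoidReasoning
  open import Defs using (module Fp)
  open Fermat using (fermat)

  instance
    p-nonZero : NonZero p
    p-nonZero = prime⇒nonZero pr

  P : ℤ
  P = + p

  -- x ≈ y : x and y are congruent modulo p, witnessed by the quotient of
  -- x - y by p.  (A record rather than a Σ-type, so that x and y can be
  -- inferred from a proof.)
  infix 4 _≈_ _≉_
  infixr 4 _,_
  record _≈_ (x y : ℤ) : Set where
    constructor _,_
    field
      quotient : ℤ
      equation : x ≡ y + quotient * P

  _≉_ : ℤ → ℤ → Set
  x ≉ y = ¬ (x ≈ y)

  ≡⇒≈ : ∀ {x y} → x ≡ y → x ≈ y
  ≡⇒≈ {x} refl = 0ℤ , sym (ℤP.+-identityʳ x)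

  -- The workhorse: if x - y is an integer combination of a - b and a' - b',
  -- the congruences a ≈ b and a' ≈ b' yield x ≈ y.  The needed identity in ℤ
  -- is always discharged by the ring solver.
  combine₂ : ∀ {a b a' b'} (c d : ℤ) {x y} → a ≈ b → a' ≈ b' →
             x - y ≡ c * (a - b) + d * (a' - b') → x ≈ y
  combine₂ {a} {b} {a'} {b'} c d {x} {y} (k , a≡) (k' , a'≡) x-y≡ = c * k + d * k' , (begin
    x                                                  ≡⟨ shift x y ⟩
    y + (x - y)                                        ≡⟨ cong (λ z → y + z) x-y≡ ⟩
    y + (c * (a - b) + d * (a' - b'))                  ≡⟨ cong₂ (λ z w → y + (c * (z - b) + d * (w - b'))) a≡ a'≡ ⟩
    y + (c * (b + k * P - b) + d * (b' + k' * P - b')) ≡⟨ cong (λ z → y + z) (cancel b k P c b' k' d) ⟩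
    y + (c * k + d * k') * P                           ∎)
    where
    open ≡-Reasoning
    shift : ∀ x y → x ≡ y + (x - y)
    shift = solve-∀
    cancel : ∀ b k P c b' k' d → c * (b + k * P - b) + d * (b' + k' * P - b') ≡ (c * k + d * k') * P
    cancel = solve-∀

  combine : ∀ {a b} (c : ℤ) {x y} → a ≈ b → x - y ≡ c * (a - b) → x ≈ y
  combine c a≈b x-y≡ = combine₂ c 0ℤ a≈b (≡⇒≈ {0ℤ} refl) (trans x-y≡ (sym (ℤP.+-identityʳ _)))

  ≈-refl : ∀ {x} → x ≈ x
  ≈-refl = ≡⇒≈ refl

  ≈-sym : ∀ {x y} → x ≈ y → y ≈ x
  ≈-sym {x} {y} x≈y = combine (- 1ℤ) x≈y (identity x y)
    where
    identity : ∀ x y → y - x ≡ - 1ℤ * (x - y)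
    identity = solve-∀

  ≈-trans : ∀ {x y z} → x ≈ y → y ≈ z → x ≈ z
  ≈-trans {x} {y} {z} x≈y y≈z = combine₂ 1ℤ 1ℤ x≈y y≈z (identity x y z)
    where
    identity : ∀ x y z → x - z ≡ 1ℤ * (x - y) + 1ℤ * (y - z)
    identity = solve-∀

  *-cong : ∀ {x x' y y'} → x ≈ x' → y ≈ y' → x * y ≈ x' * y'
  *-cong {x} {x'} {y} {y'} x≈ y≈ = combine₂ y x' x≈ y≈ (identity x x' y y')
    where
    identity : ∀ x x' y y' → x * y - x' * y' ≡ y * (x - x') + x' * (y - y')
    identity = solve-∀

  -‿cong : ∀ {x x' y y'} → x ≈ x' → y ≈ y' → x - y ≈ x' - y'
  -‿cong {x} {x'} {y} {y'} x≈ y≈ = combine₂ 1ℤ (- 1ℤ) x≈ y≈ (identity x x' y y')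
    where
    identity : ∀ x x' y y' → (x - y) - (x' - y') ≡ 1ℤ * (x - x') + - 1ℤ * (y - y')
    identity = solve-∀

  ^-cong : ∀ {x y} n → x ≈ y → x ^ n ≈ y ^ n
  ^-cong zero    x≈y = ≈-refl
  ^-cong (suc n) x≈y = *-cong x≈y (^-cong n x≈y)

  ≈⇒-≈0 : ∀ {x y} → x ≈ y → x - y ≈ 0ℤ
  ≈⇒-≈0 {x} {y} x≈y = combine 1ℤ x≈y (identity x y)
    where
    identity : ∀ x y → x - y - 0ℤ ≡ 1ℤ * (x - y)
    identity = solve-∀

  -≈0⇒≈ : ∀ {x y} → x - y ≈ 0ℤ → x ≈ y
  -≈0⇒≈ {x} {y} x-y≈0 = combine 1ℤ x-y≈0 (identity x y)
    where
    identity : ∀ x y → x - y ≡ 1ℤ * (x - y - 0ℤ)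
    identity = solve-∀

  P≈0 : P ≈ 0ℤ
  P≈0 = 1ℤ , sym (trans (ℤP.+-identityˡ (1ℤ * P)) (ℤP.*-identityˡ P))

  p∣∣x∣⇒x≈0 : ∀ x → p ∣ ∣ x ∣ → x ≈ 0ℤ
  p∣∣x∣⇒x≈0 (+ n)    (divides q n≡qp) =
    + q , trans (cong +_ n≡qp) (trans (ℤP.pos-* q p) (sym (ℤP.+-identityˡ _)))
  p∣∣x∣⇒x≈0 -[1+ n ] (divides q n≡qp) = - + q , (begin
    - + suc n        ≡⟨ cong (λ z → - + z) n≡qp ⟩
    - + (q ℕ.* p)    ≡⟨ cong -_ (ℤP.pos-* q p) ⟩
    - (+ q * P)      ≡⟨ ℤP.neg-distribˡ-* (+ q) P ⟩
    - + q * P        ≡⟨ sym (ℤP.+-identityˡ _) ⟩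
    0ℤ + - + q * P   ∎)
    where open ≡-Reasoning

  integral : ∀ x y → x * y ≈ 0ℤ → x ≈ 0ℤ ⊎ y ≈ 0ℤ
  integral x y (k , xy≡) with euclidsLemma ∣ x ∣ ∣ y ∣ pr (divides ∣ k ∣ |xy|≡)
    where
    |xy|≡ : ∣ x ∣ ℕ.* ∣ y ∣ ≡ ∣ k ∣ ℕ.* p
    |xy|≡ = trans (sym (ℤP.abs-* x y))
              (trans (cong ∣_∣ (trans xy≡ (ℤP.+-identityˡ (k * P)))) (ℤP.abs-* k P))
  ... | inj₁ p∣x = inj₁ (p∣∣x∣⇒x≈0 x p∣x)
  ... | inj₂ p∣y = inj₂ (p∣∣x∣⇒x≈0 y p∣y)

  *≈0⇔ : ∀ x y → x * y ≈ 0ℤ ⇔ (x ≈ 0ℤ ⊎ y ≈ 0ℤ)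
  *≈0⇔ x y = mk⇔ (integral x y) from
    where
    from : x ≈ 0ℤ ⊎ y ≈ 0ℤ → x * y ≈ 0ℤ
    from (inj₁ x≈0) = ≈-trans (*-cong x≈0 (≈-refl {y})) (≡⇒≈ (ℤP.*-zeroˡ y))
    from (inj₂ y≈0) = ≈-trans (*-cong (≈-refl {x}) y≈0) (≡⇒≈ (ℤP.*-zeroʳ x))

  *-nonzero : ∀ {x y} → x ≉ 0ℤ → y ≉ 0ℤ → x * y ≉ 0ℤ
  *-nonzero {x} {y} x≉0 y≉0 xy≈0 = [ x≉0 , y≉0 ]′ (integral x y xy≈0)

  *-cancelʳ : ∀ {x y z} → z ≉ 0ℤ → x * z ≈ y * z → x ≈ y
  *-cancelʳ {x} {y} {z} z≉0 xz≈yz with integral (x - y) z (combine 1ℤ xz≈yz (identity x y z))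
    where
    identity : ∀ x y z → (x - y) * z - 0ℤ ≡ 1ℤ * (x * z - y * z)
    identity = solve-∀
  ... | inj₁ x-y≈0 = -≈0⇒≈ x-y≈0
  ... | inj₂ z≈0   = ⊥-elim (z≉0 z≈0)

  %-≈ : ∀ x → + (x % p) ≈ + x
  %-≈ x = ≈-sym (+ (x / p) , (begin
    + x                          ≡⟨ cong +_ (m≡m%n+[m/n]*n x p) ⟩
    + (x % p ℕ.+ x / p ℕ.* p)    ≡⟨ ℤP.pos-+ (x % p) _ ⟩
    + (x % p) + + (x / p ℕ.* p)  ≡⟨ cong (λ z → + (x % p) + z) (ℤP.pos-* (x / p) p) ⟩
    + (x % p) + + (x / p) * P    ∎))
    where open ≡-Reasoning

  ≈⇒%≡ : ∀ {x y} → + x ≈ + y → x % p ≡ y % p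
  ≈⇒%≡ {x} {y} (+ m , x≡) = trans (cong (_% p) x≡y+mp) ([m+kn]%n≡m%n y m p)
    where
    x≡y+mp : x ≡ y ℕ.+ m ℕ.* p
    x≡y+mp = ℤP.+-injective (trans x≡ (trans (cong (λ z → + y + z) (sym (ℤP.pos-* m p)))
                                                 (sym (ℤP.pos-+ y _))))
  ≈⇒%≡ {x} {y} (-[1+ m ] , x≡) = sym (trans (cong (_% p) y≡x+m'p) ([m+kn]%n≡m%n x (suc m) p))
    where
    regroup : ∀ y K P → y ≡ (y + - K * P) + K * P
    regroup = solve-∀
    y≡x+m'p : y ≡ x ℕ.+ suc m ℕ.* p
    y≡x+m'p = ℤP.+-injective (trans (regroup (+ y) (+ suc m) P)
      (trans (cong (λ z → z + + suc m * P) (sym x≡))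
        (trans (cong (λ z → + x + z) (sym (ℤP.pos-* (suc m) p))) (sym (ℤP.pos-+ x _)))))

  %≡⇒≈ : ∀ {x y} → x % p ≡ y % p → + x ≈ + y
  %≡⇒≈ {x} {y} x%≡y% = ≈-trans (≈-sym (%-≈ x)) (≈-trans (≡⇒≈ (cong +_ x%≡y%)) (%-≈ y))

  ≈⇒≡ : ∀ {x y} → x ℕ.< p → y ℕ.< p → + x ≈ + y → x ≡ y
  ≈⇒≡ x<p y<p x≈y = trans (sym (m<n⇒m%n≡m x<p)) (trans (≈⇒%≡ x≈y) (m<n⇒m%n≡m y<p))

  rep : ℤ → ℕ
  rep x = x %ℕ p

  rep<p : ∀ x → rep x ℕ.< p
  rep<p x = n%ℕd<d x p

  rep-≈ : ∀ x → + rep x ≈ x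
  rep-≈ x = ≈-sym (x /ℕ p , a≡a%ℕn+[a/ℕn]*n x p)

  pos-^ : ∀ r n → + (r ℕ.^ n) ≡ (+ r) ^ n
  pos-^ r zero    = refl
  pos-^ r (suc n) = trans (ℤP.pos-* r (r ℕ.^ n)) (cong (λ z → + r * z) (pos-^ r n))

  fermat-≈ : ∀ x → x ^ p ≈ x
  fermat-≈ x =
    ≈-trans (^-cong p (≈-sym (rep-≈ x)))
      (≈-trans (≡⇒≈ (sym (pos-^ (rep x) p))) (≈-trans (m , r^p≡) (rep-≈ x)))
    where
    m = + proj₁ (fermat pr (rep x))
    r^p≡ : + (rep x ℕ.^ p) ≡ + rep x + m * P
    r^p≡ = trans (cong +_ (proj₂ (fermat pr (rep x))))
             (trans (ℤP.pos-+ (rep x) _) (cong (λ z → + rep x + z) (ℤP.pos-* (proj₁ (fermat pr (rep x))) p)))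

  -- The inverse of Defs, x⁻¹ = x^(p-2), is a multiplicative inverse of
  -- every x ≉ 0: from x · (x · x^(p-2)) = x^p ≈ x, cancel x.
  iv : ℤ → ℤ
  iv x = x ^ (p ℕ.∸ 2)

  iv-cong : ∀ {x y} → x ≈ y → iv x ≈ iv y
  iv-cong = ^-cong (p ℕ.∸ 2)

  inverse : ∀ x → x ≉ 0ℤ → x * iv x ≈ 1ℤ
  inverse x x≉0 = *-cancelʳ x≉0 (combine 1ℤ x²iv≈x (identity x (iv x)))
    where
    2≤p : 2 ℕ.≤ p
    2≤p = ℕ.nonTrivial⇒n>1 p ⦃ prime⇒nonTrivial pr ⦄
    x²iv≈x : x * (x * iv x) ≈ x
    x²iv≈x = subst (λ n → x ^ n ≈ x) (sym (ℕP.m+[n∸m]≡n 2≤p)) (fermat-≈ x)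
    identity : ∀ x v → x * v * x - 1ℤ * x ≡ 1ℤ * (x * (x * v) - x)
    identity = solve-∀

  *≈1⇒≈iv : ∀ {A E} → E ≉ 0ℤ → A * E ≈ 1ℤ → A ≈ iv E
  *≈1⇒≈iv {A} {E} E≉0 AE≈1 = combine₂ (iv E) (- A) AE≈1 (inverse E E≉0) (identity A E (iv E))
    where
    identity : ∀ A E v → A - v ≡ v * (A * E - 1ℤ) + - A * (E * v - 1ℤ)
    identity = solve-∀

  ≈iv⇒*≈1 : ∀ {A E} → E ≉ 0ℤ → A ≈ iv E → A * E ≈ 1ℤ
  ≈iv⇒*≈1 {A} {E} E≉0 A≈iv = combine₂ E 1ℤ A≈iv (inverse E E≉0) (identity A E (iv E))
    where
    identity : ∀ A E v → A * E - 1ℤ ≡ E * (A - v) + 1ℤ * (E * v - 1ℤ)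
    identity = solve-∀

  iv-injective : ∀ {x y} → x ≉ 0ℤ → y ≉ 0ℤ → iv x ≈ iv y → x ≈ y
  iv-injective {x} {y} x≉0 y≉0 ivx≈ivy = combine₂ y (- x) x·ivy≈1 (inverse y y≉0) (identity x y (iv y))
    where
    x·ivy≈1 : x * iv y ≈ 1ℤ
    x·ivy≈1 = ≈-trans (*-cong (≈-refl {x}) (≈-sym ivx≈ivy)) (inverse x x≉0)
    identity : ∀ x y v → x - y ≡ y * (x * v - 1ℤ) + - x * (y * v - 1ℤ)
    identity = solve-∀

  open Fp p using (_⊗_; _⊖_; inv)

  ⊗-≈ : ∀ x y → + (x ⊗ y) ≈ + x * + y
  ⊗-≈ x y = ≈-trans (%-≈ (x ℕ.* y)) (≡⇒≈ (ℤP.pos-* x y))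

  ⊖-≈ : ∀ x y → + (x ⊖ y) ≈ + x - + y
  ⊖-≈ x y = ≈-trans (%-≈ _) (≈-trans (≡⇒≈ (ℤP.pos-+ x _)) (≈-trans (≡⇒≈ (cong (λ z → + x + z) p∸y%≡))
              (combine₂ 1ℤ (- 1ℤ) P≈0 (%-≈ y) (identity (+ x) P (+ (y % p)) (+ y)))))
    where
    p∸y%≡ : + (p ℕ.∸ y % p) ≡ P - + (y % p)
    p∸y%≡ = sym (trans (ℤP.m-n≡m⊖n p (y % p)) (ℤP.⊖-≥ (ℕP.<⇒≤ (m%n<n y p))))
    identity : ∀ X P Y' Y → (X + (P - Y')) - (X - Y) ≡ 1ℤ * (P - 0ℤ) + - 1ℤ * (Y' - Y)
    identity = solve-∀

  inv-≈ : ∀ x → + (inv x) ≈ iv (+ x)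
  inv-≈ x = ≈-trans (%-≈ _) (≡⇒≈ (pos-^ x (p ℕ.∸ 2)))

  small≉0 : ∀ c → 0 ℕ.< c → c ℕ.< p → + c ≉ 0ℤ
  small≉0 c 0<c c<p c≈0 = ℕP.<⇒≢ 0<c (sym (≈⇒≡ c<p (ℕP.<-trans 0<c c<p) c≈0))

  ≈-setoid : Setoid _ _
  ≈-setoid = record
    { Carrier = ℤ ; _≈_ = _≈_
    ; isEquivalence = record { refl = ≈-refl ; sym = ≈-sym ; trans = ≈-trans } }

  module ≈-Reasoning = SetoidReasoning ≈-setoid

-- Finite counting: cardinalities of filtered lists as sums of indicators.
module Counting where
  open import Data.Nat using (ℕ; zero; suc; _+_; _*_; _∸_; _<_; s≤s)
  open import Data.Nat.Properties
  open import Data.Fin using (Fin; zero; suc; toℕ)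
  open import Data.List using (List; []; _∷_; _++_; map; tabulate; filter; length; cartesianProduct; allFin)
  open import Data.List.Properties using (map-tabulate)
  open import Data.List.Relation.Unary.All using (All; []; _∷_)
  open import Data.List.Relation.Unary.AllPairs using ([]; _∷_)
  open import Data.List.Relation.Unary.Unique.Propositional using (Unique)
  open import Data.List.Relation.Unary.Any using (here; there)
  open import Data.List.Membership.Propositional using (_∉_)
  open import Data.List.Membership.DecPropositional _≟_ using (_∉?_)
  import Data.List.Relation.Unary.All as All
  open import Data.Product using (_×_; _,_)
  open import Data.Empty using (⊥-elim)
  open import Function using (_∘_; id; _⇔_; mk⇔; Equivalence)
  open import Relation.Nullary using (Dec; yes; no; ¬_)
  open import Relation.Unary using (Pred; Decidable)
  open import Relation.Binary.PropositionalEquality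
  open import Algebra.Properties.Semiring.Sum +-*-semiring using (sum-syntax; sum-cong-≗; ∑-distrib-+; ∑-comm; *-distribʳ-sum)

  ind : ∀ {ℓ} {P : Set ℓ} → Dec P → ℕ
  ind (yes _) = 1
  ind (no _)  = 0

  ind-yes : ∀ {ℓ} {P : Set ℓ} (d : Dec P) → P → ind d ≡ 1
  ind-yes (yes _) _  = refl
  ind-yes (no ¬p) p  = ⊥-elim (¬p p)

  ind-no : ∀ {ℓ} {P : Set ℓ} (d : Dec P) → ¬ P → ind d ≡ 0
  ind-no (yes p) ¬p = ⊥-elim (¬p p)
  ind-no (no _)  _  = refl

  ind-⇔ : ∀ {ℓ ℓ'} {P : Set ℓ} {Q : Set ℓ'} (d : Dec P) (e : Dec Q) → P ⇔ Q → ind d ≡ ind e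
  ind-⇔ (yes p) e P⇔Q = sym (ind-yes e (Equivalence.to P⇔Q p))
  ind-⇔ (no ¬p) e P⇔Q = sym (ind-no e (¬p ∘ Equivalence.from P⇔Q))

  module _ {a ℓ} {A : Set a} {P : Pred A ℓ} (P? : Decidable P) where

    count : List A → ℕ
    count xs = length (filter P? xs)

    count-∷ : ∀ x xs → count (x ∷ xs) ≡ ind (P? x) + count xs
    count-∷ x xs with P? x
    ... | yes _ = refl
    ... | no _  = refl

    count-++ : ∀ xs ys → count (xs ++ ys) ≡ count xs + count ys
    count-++ []       ys = refl
    count-++ (x ∷ xs) ys = begin
      count (x ∷ xs ++ ys)                  ≡⟨ count-∷ x (xs ++ ys) ⟩
      ind (P? x) + count (xs ++ ys)         ≡⟨ cong (ind (P? x) +_) (count-++ xs ys) ⟩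
      ind (P? x) + (count xs + count ys)    ≡⟨ sym (+-assoc (ind (P? x)) _ _) ⟩
      ind (P? x) + count xs + count ys      ≡⟨ cong (_+ count ys) (sym (count-∷ x xs)) ⟩
      count (x ∷ xs) + count ys             ∎
      where open ≡-Reasoning

    count-tabulate : ∀ {n} (f : Fin n → A) → count (tabulate f) ≡ ∑[ i < n ] ind (P? (f i))
    count-tabulate {zero}  f = refl
    count-tabulate {suc n} f =
      trans (count-∷ (f zero) _) (cong (ind (P? (f zero)) +_) (count-tabulate (f ∘ suc)))

  count-pairs : ∀ {ℓ} {m n} {P : Pred (Fin m × Fin n) ℓ} (P? : Decidable P) →
                count P? (cartesianProduct (allFin m) (allFin n)) ≡ ∑[ j < n ] ∑[ i < m ] ind (P? (i , j))
  count-pairs {m = m} {n} P? = trans (by-rows m id) (∑-comm (λ i j → ind (P? (i , j))))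
    where
    by-rows : ∀ k (f : Fin k → Fin m) →
              count P? (cartesianProduct (tabulate f) (allFin n)) ≡ ∑[ i < k ] ∑[ j < n ] ind (P? (f i , j))
    by-rows zero    f = refl
    by-rows (suc k) f = begin
      count P? (map (f zero ,_) (allFin n) ++ cartesianProduct (tabulate (f ∘ suc)) (allFin n))
        ≡⟨ count-++ P? (map (f zero ,_) (allFin n)) _ ⟩
      count P? (map (f zero ,_) (allFin n)) + count P? (cartesianProduct (tabulate (f ∘ suc)) (allFin n))
        ≡⟨ cong₂ _+_ row (by-rows k (f ∘ suc)) ⟩
      ∑[ j < n ] ind (P? (f zero , j)) + ∑[ i < k ] ∑[ j < n ] ind (P? (f (suc i) , j))
        ∎
      where
      open ≡-Reasoning
      row : count P? (map (f zero ,_) (allFin n)) ≡ ∑[ j < n ] ind (P? (f zero , j))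
      row = trans (cong (count P?) (map-tabulate id (f zero ,_))) (count-tabulate P? (f zero ,_))

  ∑-zeros : ∀ n → ∑[ i < n ] 0 ≡ 0
  ∑-zeros zero    = refl
  ∑-zeros (suc n) = ∑-zeros n

  ∑-ones : ∀ n → ∑[ i < n ] 1 ≡ n
  ∑-ones zero    = refl
  ∑-ones (suc n) = cong suc (∑-ones n)

  count-point : ∀ {n} e → e < n → ∑[ i < n ] ind (toℕ i ≟ e) ≡ 1
  count-point {suc n} zero    _         =
    cong suc (trans (sum-cong-≗ {n} (λ i → ind-no (toℕ (suc i) ≟ 0) λ ())) (∑-zeros n))
  count-point {suc n} (suc e) (s≤s e<n) =
    trans (sum-cong-≗ {n} (λ i → ind-⇔ (toℕ (suc i) ≟ suc e) (toℕ i ≟ e) (mk⇔ suc-injective (cong suc))))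
          (count-point e e<n)

  count-point-weighted : ∀ {n} e c → e < n → ∑[ i < n ] (ind (toℕ i ≟ e) * c) ≡ c
  count-point-weighted {n} e c e<n = begin
    ∑[ i < n ] (ind (toℕ i ≟ e) * c)   ≡⟨ sym (*-distribʳ-sum {n} c (λ i → ind (toℕ i ≟ e))) ⟩
    (∑[ i < n ] ind (toℕ i ≟ e)) * c   ≡⟨ cong (_* c) (count-point e e<n) ⟩
    1 * c                              ≡⟨ *-identityˡ c ⟩
    c                                  ∎
    where open ≡-Reasoning

  count-outside : ∀ n L → Unique L → All (_< n) L → ∑[ i < n ] ind (toℕ i ∉? L) ≡ n ∸ length L
  count-outside n []      _           _            =
    trans (sum-cong-≗ {n} (λ i → ind-yes (toℕ i ∉? []) λ ())) (∑-ones n)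
  count-outside n (e ∷ L) (e∉L ∷ L!) (e<n ∷ L<n) = begin
    outside                                                         ≡⟨ sym (m+n∸n≡m outside 1) ⟩
    outside + 1 ∸ 1                                                 ≡⟨ cong (λ z → outside + z ∸ 1) (sym (count-point {n} e e<n)) ⟩
    outside + ∑[ i < n ] ind (toℕ i ≟ e) ∸ 1                        ≡⟨ cong (_∸ 1) (sym (∑-distrib-+ {n} (λ i → ind (toℕ i ∉? e ∷ L)) (λ i → ind (toℕ i ≟ e)))) ⟩
    ∑[ i < n ] (ind (toℕ i ∉? e ∷ L) + ind (toℕ i ≟ e)) ∸ 1         ≡⟨ cong (_∸ 1) (sum-cong-≗ {n} (λ i → split (toℕ i) (toℕ i ≟ e))) ⟩
    ∑[ i < n ] ind (toℕ i ∉? L) ∸ 1                                 ≡⟨ cong (_∸ 1) (count-outside n L L! L<n) ⟩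
    n ∸ length L ∸ 1                                                ≡⟨ ∸-+-assoc n (length L) 1 ⟩
    n ∸ (length L + 1)                                              ≡⟨ cong (n ∸_) (+-comm (length L) 1) ⟩
    n ∸ length (e ∷ L)                                              ∎
    where
    open ≡-Reasoning
    outside = ∑[ i < n ] ind (toℕ i ∉? e ∷ L)
    e∉L′ : e ∉ L
    e∉L′ e∈L = All.lookup e∉L e∈L refl
    split : ∀ x (x≟e : Dec (x ≡ e)) → ind (x ∉? e ∷ L) + ind x≟e ≡ ind (x ∉? L)
    split x (yes refl) = trans (cong (_+ 1) (ind-no (x ∉? e ∷ L) (λ x∉ → x∉ (here refl))))
                               (sym (ind-yes (x ∉? L) e∉L′))
    split x (no x≢e)   = trans (+-identityʳ _)
      (ind-⇔ (x ∉? e ∷ L) (x ∉? L) (mk⇔ (λ x∉ x∈ → x∉ (there x∈))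
                                        (λ { x∉ (here x≡e) → x≢e x≡e ; x∉ (there x∈) → x∉ x∈ })))

-- The defining condition of S(N), for a fixed n = N ≉ 0 in F_p, in terms
-- of the polynomials Q(a) = (a-1)² - n and K(a) = (a-1)² - n a².
module Condition (p : ℕ) (pr : Prime p) (p>3 : 3 < p) (n : ℤ)
                 (n≉0 : Congruence._≉_ p pr n 0ℤ) where
  open import Data.Nat as ℕ using (ℕ)
  open import Data.Nat.Primality using (Prime)
  open import Data.Integer using (ℤ; +_; _+_; _*_; _-_; -_; _^_; 0ℤ; 1ℤ)
  open Congruence p pr
  import Data.Nat.Properties as ℕP
  import Data.Integer.Properties as ℤP
  open import Data.Integer.Tactic.RingSolver using (solve-∀)
  open import Data.Product using (_×_; _,_)
  open import Data.Sum using (_⊎_; inj₁; inj₂; [_,_]′)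
  open import Data.Empty using (⊥; ⊥-elim)
  open import Function using (_∘_; _⇔_; mk⇔; Equivalence)
  open import Relation.Nullary using (¬_)
  open import Relation.Binary.PropositionalEquality using (_≡_; refl; subst)

  ≤3⇒<p : ∀ {c} → c ℕ.≤ 3 → c ℕ.< p
  ≤3⇒<p c≤3 = ℕP.≤-<-trans c≤3 p>3

  1≉0 : 1ℤ ≉ 0ℤ
  1≉0 = small≉0 1 (ℕ.s≤s ℕ.z≤n) (≤3⇒<p (ℕ.s≤s ℕ.z≤n))

  2≉0 : + 2 ≉ 0ℤ
  2≉0 = small≉0 2 (ℕ.s≤s ℕ.z≤n) (≤3⇒<p (ℕ.s≤s (ℕ.s≤s ℕ.z≤n)))

  3≉0 : + 3 ≉ 0ℤ
  3≉0 = small≉0 3 (ℕ.s≤s ℕ.z≤n) (≤3⇒<p ℕP.≤-refl)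

  0≉1 : 0ℤ ≉ 1ℤ
  0≉1 0≈1 = 1≉0 (combine (- 1ℤ) 0≈1 refl)

  0≉-1 : 0ℤ ≉ - 1ℤ
  0≉-1 0≈-1 = 1≉0 (combine 1ℤ 0≈-1 refl)

  1≉-1 : 1ℤ ≉ - 1ℤ
  1≉-1 1≈-1 = 2≉0 (combine 1ℤ 1≈-1 refl)

  -- 0⁻¹ = 0^(p-2) = 0, as p - 2 > 0.
  iv-zero : iv 0ℤ ≡ 0ℤ
  iv-zero = subst (λ m → 0ℤ ^ (m ℕ.∸ 2) ≡ 0ℤ) (ℕP.m+[n∸m]≡n (ℕP.<⇒≤ p>3)) refl

  Q : ℤ → ℤ
  Q A = (A - 1ℤ) * (A - 1ℤ) - n

  K : ℤ → ℤ
  K A = (A - 1ℤ) * (A - 1ℤ) - n * (A * A)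

  L : ℤ → ℤ → ℤ
  L U A = iv (U * A - 1ℤ) * (U * iv A - 1ℤ) * ((A - 1ℤ) * (A - 1ℤ))

  L-cleared : ∀ U A → U * A ≉ 1ℤ → A ≉ 0ℤ → L U A * ((U * A - 1ℤ) * A) ≈ (U - A) * ((A - 1ℤ) * (A - 1ℤ))
  L-cleared U A UA≉1 A≉0 =
    combine₂ (Z * (U * (A * iv A) - A)) (Z * U) (inverse (U * A - 1ℤ) UA-1≉0) (inverse A A≉0)
             (identity U A (iv (U * A - 1ℤ)) (iv A))
    where
    Z : ℤ
    Z = (A - 1ℤ) * (A - 1ℤ)
    UA-1≉0 : U * A - 1ℤ ≉ 0ℤ
    UA-1≉0 e = UA≉1 (-≈0⇒≈ e)
    identity : ∀ U A s a →
      s * (U * a - 1ℤ) * ((A - 1ℤ) * (A - 1ℤ)) * ((U * A - 1ℤ) * A) - (U - A) * ((A - 1ℤ) * (A - 1ℤ))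
      ≡ ((A - 1ℤ) * (A - 1ℤ) * (U * (A * a) - A)) * ((U * A - 1ℤ) * s - 1ℤ)
        + ((A - 1ℤ) * (A - 1ℤ) * U) * (A * a - 1ℤ)
    identity = solve-∀

  -- With cleared denominators, L(U,A) ≈ n becomes linear in U:
  --   (U - A)(A - 1)² - n (UA - 1) A = U K(A) - A Q(A).
  private
    linearise : ∀ U A n →
      (U - A) * ((A - 1ℤ) * (A - 1ℤ)) - n * ((U * A - 1ℤ) * A)
      ≡ 1ℤ * (U * ((A - 1ℤ) * (A - 1ℤ) - n * (A * A)) - A * ((A - 1ℤ) * (A - 1ℤ) - n))
    linearise = solve-∀
    linearise⁻¹ : ∀ U A n →
      U * ((A - 1ℤ) * (A - 1ℤ) - n * (A * A)) - A * ((A - 1ℤ) * (A - 1ℤ) - n)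
      ≡ 1ℤ * ((U - A) * ((A - 1ℤ) * (A - 1ℤ)) - n * ((U * A - 1ℤ) * A))
    linearise⁻¹ = solve-∀

  -- The main reduction: for A ≉ 0, L(U,A) ≈ n iff UA ≉ 1 and U K(A) ≈ A Q(A).
  -- (If UA ≈ 1 then L(U,A) ≈ 0⁻¹ · … ≈ 0 ≉ n.)
  L≈n⇔ : ∀ U A → A ≉ 0ℤ → L U A ≈ n ⇔ (U * A ≉ 1ℤ × U * K A ≈ A * Q A)
  L≈n⇔ U A A≉0 = mk⇔ to from
    where
    to : L U A ≈ n → U * A ≉ 1ℤ × U * K A ≈ A * Q A
    to L≈n = UA≉1 , combine 1ℤ (≈-trans (≈-sym (L-cleared U A UA≉1 A≉0)) (*-cong L≈n ≈-refl)) (linearise⁻¹ U A n)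
      where
      UA≉1 : U * A ≉ 1ℤ
      UA≉1 UA≈1 = n≉0 (begin
        n                                              ≈⟨ ≈-sym L≈n ⟩
        L U A                                          ≈⟨ *-cong (*-cong iv0 (≈-refl {U * iv A - 1ℤ})) ≈-refl ⟩
        0ℤ * (U * iv A - 1ℤ) * ((A - 1ℤ) * (A - 1ℤ))   ≡⟨ zero-product (U * iv A - 1ℤ) ((A - 1ℤ) * (A - 1ℤ)) ⟩
        0ℤ                                             ∎)
        where
        open ≈-Reasoning
        iv0 : iv (U * A - 1ℤ) ≈ 0ℤ
        iv0 = ≈-trans (iv-cong (≈⇒-≈0 UA≈1)) (≡⇒≈ iv-zero)
        zero-product : ∀ y z → 0ℤ * y * z ≡ 0ℤ
        zero-product = solve-∀
    from : U * A ≉ 1ℤ × U * K A ≈ A * Q A → L U A ≈ n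
    from (UA≉1 , UK≈AQ) = *-cancelʳ (*-nonzero (λ e → UA≉1 (-≈0⇒≈ e)) A≉0)
      (≈-trans (L-cleared U A UA≉1 A≉0) (combine 1ℤ UK≈AQ (linearise U A n)))

  -- The conditions defining (U, A) ∈ S(n), with L(U,A) ≈ n already reduced.
  record Member (U A : ℤ) : Set where
    field
      U≉0    : U ≉ 0ℤ
      A≉0    : A ≉ 0ℤ
      A≉1    : A ≉ 1ℤ
      U≉A    : U ≉ A
      UA≉1   : U * A ≉ 1ℤ
      linear : U * K A ≈ A * Q A

  -- The values of a for which the equation u K(a) = a Q(a) does not have
  -- exactly one admissible solution u.
  data Degenerate (A : ℤ) : Set where
    at-0   : A ≈ 0ℤ → Degenerate A
    at-1   : A ≈ 1ℤ → Degenerate A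
    at-−1  : A ≈ - 1ℤ → Degenerate A
    K-root : K A ≈ 0ℤ → Degenerate A
    Q-root : Q A ≈ 0ℤ → Degenerate A

  Q-cong : ∀ {A B} → A ≈ B → Q A ≈ Q B
  Q-cong A≈B = -‿cong (*-cong (-‿cong A≈B ≈-refl) (-‿cong A≈B ≈-refl)) ≈-refl

  K-cong : ∀ {A B} → A ≈ B → K A ≈ K B
  K-cong A≈B = -‿cong (*-cong (-‿cong A≈B ≈-refl) (-‿cong A≈B ≈-refl)) (*-cong (≈-refl {n}) (*-cong A≈B A≈B))

  Degenerate-resp : ∀ {A B} → A ≈ B → Degenerate A → Degenerate B
  Degenerate-resp A≈B (at-0 e)   = at-0 (≈-trans (≈-sym A≈B) e)
  Degenerate-resp A≈B (at-1 e)   = at-1 (≈-trans (≈-sym A≈B) e)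
  Degenerate-resp A≈B (at-−1 e)  = at-−1 (≈-trans (≈-sym A≈B) e)
  Degenerate-resp A≈B (K-root e) = K-root (≈-trans (K-cong (≈-sym A≈B)) e)
  Degenerate-resp A≈B (Q-root e) = Q-root (≈-trans (Q-cong (≈-sym A≈B)) e)

  +1≈0⇔≈-1 : ∀ {A} → A + 1ℤ ≈ 0ℤ ⇔ A ≈ - 1ℤ
  +1≈0⇔≈-1 {A} = mk⇔ (λ e → combine 1ℤ e (identity A)) (λ e → combine 1ℤ e (identity⁻¹ A))
    where
    identity : ∀ A → A - - 1ℤ ≡ 1ℤ * (A + 1ℤ - 0ℤ)
    identity = solve-∀
    identity⁻¹ : ∀ A → A + 1ℤ - 0ℤ ≡ 1ℤ * (A - - 1ℤ)
    identity⁻¹ = solve-∀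

  A²-1≉0 : ∀ {A} → A ≉ 1ℤ → A ≉ - 1ℤ → (A - 1ℤ) * (A + 1ℤ) ≉ 0ℤ
  A²-1≉0 A≉1 A≉-1 = *-nonzero (λ e → A≉1 (-≈0⇒≈ e)) (λ e → A≉-1 (Equivalence.to +1≈0⇔≈-1 e))

  -- Q and K have no common root outside {0, 1, -1}:  A Q(A) - A K(A) = n A (A-1)(A+1).
  common-root : ∀ {A} → K A ≈ 0ℤ → Q A ≈ 0ℤ → A ≈ 0ℤ ⊎ A ≈ 1ℤ ⊎ A ≈ - 1ℤ
  common-root {A} K≈0 Q≈0 with integral (n * A) ((A - 1ℤ) * (A + 1ℤ)) (combine₂ A (- A) Q≈0 K≈0 (identity A n))
    where
    identity : ∀ A n → n * A * ((A - 1ℤ) * (A + 1ℤ)) - 0ℤ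
                       ≡ A * ((A - 1ℤ) * (A - 1ℤ) - n - 0ℤ) + - A * ((A - 1ℤ) * (A - 1ℤ) - n * (A * A) - 0ℤ)
    identity = solve-∀
  ... | inj₁ nA≈0 = [ (λ n≈0 → ⊥-elim (n≉0 n≈0)) , inj₁ ]′ (integral n A nA≈0)
  ... | inj₂ A²-1≈0 with integral (A - 1ℤ) (A + 1ℤ) A²-1≈0
  ...   | inj₁ A-1≈0 = inj₂ (inj₁ (-≈0⇒≈ A-1≈0))
  ...   | inj₂ A+1≈0 = inj₂ (inj₂ (Equivalence.to +1≈0⇔≈-1 A+1≈0))

  -- K(0) = 1.
  K[0]≉0 : K 0ℤ ≉ 0ℤ
  K[0]≉0 K[0]≈0 = 1≉0 (combine 1ℤ K[0]≈0 (identity n))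
    where
    identity : ∀ n → 1ℤ - 0ℤ ≡ 1ℤ * ((0ℤ - 1ℤ) * (0ℤ - 1ℤ) - n * (0ℤ * 0ℤ) - 0ℤ)
    identity = solve-∀

  Q-at-−1 : ∀ {A} → A ≈ - 1ℤ → Q A ≈ + 4 - n
  Q-at-−1 {A} A≈-1 = combine (A - + 3) A≈-1 (identity A n)
    where
    identity : ∀ A n → (A - 1ℤ) * (A - 1ℤ) - n - (+ 4 - n) ≡ (A - + 3) * (A - - 1ℤ)
    identity = solve-∀

  K-at-−1 : ∀ {A} → A ≈ - 1ℤ → K A ≈ + 4 - n
  K-at-−1 {A} A≈-1 = combine (A - + 3 - n * (A - 1ℤ)) A≈-1 (identity A n)
    where
    identity : ∀ A n → (A - 1ℤ) * (A - 1ℤ) - n * (A * A) - (+ 4 - n) ≡ (A - + 3 - n * (A - 1ℤ)) * (A - - 1ℤ)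
    identity = solve-∀

  -- A member with a = -1 forces n = 4: there U(4 - n) ≈ -(4 - n), and
  -- U ≈ -1 is excluded by U ≉ A.
  member-at-−1 : ∀ {U A} → Member U A → A ≈ - 1ℤ → n ≈ + 4
  member-at-−1 {U} {A} m A≈-1 =
    [ (λ U+1≈0 → ⊥-elim (U≉A (≈-trans (Equivalence.to +1≈0⇔≈-1 U+1≈0) (≈-sym A≈-1))))
    , (λ 4-n≈0 → ≈-sym (-≈0⇒≈ 4-n≈0))
    ]′ (integral (U + 1ℤ) (+ 4 - n) [U+1][4-n]≈0)
    where
    open Member m
    U[4-n]≈n-4 : U * (+ 4 - n) ≈ - 1ℤ * (+ 4 - n)
    U[4-n]≈n-4 = begin
      U * (+ 4 - n)          ≈⟨ *-cong (≈-refl {U}) (≈-sym (K-at-−1 A≈-1)) ⟩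
      U * K A                ≈⟨ linear ⟩
      A * Q A                ≈⟨ *-cong A≈-1 (Q-at-−1 A≈-1) ⟩
      - 1ℤ * (+ 4 - n)       ∎
      where open ≈-Reasoning
    identity : ∀ U n → (U + 1ℤ) * (+ 4 - n) - 0ℤ ≡ 1ℤ * (U * (+ 4 - n) - - 1ℤ * (+ 4 - n))
    identity = solve-∀
    [U+1][4-n]≈0 : (U + 1ℤ) * (+ 4 - n) ≈ 0ℤ
    [U+1][4-n]≈0 = combine 1ℤ U[4-n]≈n-4 (identity U n)

  member-at-common-root : ∀ {U A} → Member U A → K A ≈ 0ℤ → Q A ≈ 0ℤ → A ≈ - 1ℤ × n ≈ + 4
  member-at-common-root {U} {A} m K≈0 Q≈0 = at (common-root K≈0 Q≈0)
    where
    at : A ≈ 0ℤ ⊎ A ≈ 1ℤ ⊎ A ≈ - 1ℤ → A ≈ - 1ℤ × n ≈ + 4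
    at (inj₁ A≈0)         = ⊥-elim (Member.A≉0 m A≈0)
    at (inj₂ (inj₁ A≈1))  = ⊥-elim (Member.A≉1 m A≈1)
    at (inj₂ (inj₂ A≈-1)) = A≈-1 , member-at-−1 m A≈-1

  degenerate-fiber : ∀ {U A} → Degenerate A → ¬ (A ≈ - 1ℤ × n ≈ + 4) → ¬ Member U A
  degenerate-fiber {U} {A} degenerate not-special m = absurd degenerate
    where
    open Member m
    absurd : Degenerate A → ⊥
    absurd (at-0 A≈0)   = A≉0 A≈0
    absurd (at-1 A≈1)   = A≉1 A≈1
    absurd (at-−1 A≈-1) = not-special (A≈-1 , member-at-−1 m A≈-1)
    -- a root of either side of U K(A) ≈ A Q(A) is a root of the other
    absurd (K-root K≈0) = not-special (member-at-common-root m K≈0 Q≈0)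
      where
      AQ≈0 : A * Q A ≈ 0ℤ
      AQ≈0 = begin
        A * Q A    ≈⟨ ≈-sym linear ⟩
        U * K A    ≈⟨ *-cong (≈-refl {U}) K≈0 ⟩
        U * 0ℤ     ≡⟨ ℤP.*-zeroʳ U ⟩
        0ℤ         ∎
        where open ≈-Reasoning
      Q≈0 : Q A ≈ 0ℤ
      Q≈0 = [ (λ A≈0 → ⊥-elim (A≉0 A≈0)) , (λ Q≈0 → Q≈0) ]′ (integral A (Q A) AQ≈0)
    absurd (Q-root Q≈0) = not-special (member-at-common-root m K≈0 Q≈0)
      where
      UK≈0 : U * K A ≈ 0ℤ
      UK≈0 = begin
        U * K A    ≈⟨ linear ⟩
        A * Q A    ≈⟨ *-cong (≈-refl {A}) Q≈0 ⟩
        A * 0ℤ     ≡⟨ ℤP.*-zeroʳ A ⟩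
        0ℤ         ∎
        where open ≈-Reasoning
      K≈0 : K A ≈ 0ℤ
      K≈0 = [ (λ U≈0 → ⊥-elim (U≉0 U≈0)) , (λ K≈0 → K≈0) ]′ (integral U (K A) UK≈0)

  generic-fiber : ∀ {U A} → ¬ Degenerate A → Member U A ⇔ U ≈ A * Q A * iv (K A)
  generic-fiber {U} {A} nondegenerate = mk⇔ to from
    where
    K≉0 : K A ≉ 0ℤ
    K≉0 = nondegenerate ∘ K-root
    A≉0 : A ≉ 0ℤ
    A≉0 = nondegenerate ∘ at-0
    A≉1 : A ≉ 1ℤ
    A≉1 = nondegenerate ∘ at-1
    A²-1≉0′ : (A - 1ℤ) * (A + 1ℤ) ≉ 0ℤ
    A²-1≉0′ = A²-1≉0 A≉1 (nondegenerate ∘ at-−1)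
    solve-for-U : ∀ U K M s → U - M * s ≡ - U * (K * s - 1ℤ) + s * (U * K - M)
    solve-for-U = solve-∀
    to : Member U A → U ≈ A * Q A * iv (K A)
    to m = combine₂ (- U) (iv (K A)) (inverse (K A) K≉0) (Member.linear m)
                    (solve-for-U U (K A) (A * Q A) (iv (K A)))
    from : U ≈ A * Q A * iv (K A) → Member U A
    from U≈ = record
      { U≉0 = λ U≈0 → *-nonzero A≉0 (nondegenerate ∘ Q-root)
                        (combine₂ (- 1ℤ) (K A) linear U≈0 (U≈0⇒AQ≈0 U (K A) (A * Q A)))
      ; A≉0 = A≉0
      ; A≉1 = A≉1
      ; U≉A = λ U≈A → *-nonzero (*-nonzero n≉0 A≉0) A²-1≉0′
                        (combine₂ (- 1ℤ) (K A) linear (≈⇒-≈0 U≈A) (U≈A⇒ U A n))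
      ; UA≉1 = λ UA≈1 → *-nonzero (*-nonzero A-1≉0 A-1≉0) A²-1≉0′
                          (combine₂ (- A) (K A) linear (≈⇒-≈0 UA≈1) (UA≈1⇒ U A n))
      ; linear = linear
      }
      where
      A-1≉0 : A - 1ℤ ≉ 0ℤ
      A-1≉0 e = A≉1 (-≈0⇒≈ e)
      eliminate : ∀ U K M s → U * K - M ≡ K * (U - M * s) + M * (K * s - 1ℤ)
      eliminate = solve-∀
      linear : U * K A ≈ A * Q A
      linear = combine₂ (K A) (A * Q A) U≈ (inverse (K A) K≉0) (eliminate U (K A) (A * Q A) (iv (K A)))
      U≈0⇒AQ≈0 : ∀ U K M → M - 0ℤ ≡ - 1ℤ * (U * K - M) + K * (U - 0ℤ)
      U≈0⇒AQ≈0 = solve-∀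
      U≈A⇒ : ∀ U A n → n * A * ((A - 1ℤ) * (A + 1ℤ)) - 0ℤ
        ≡ - 1ℤ * (U * ((A - 1ℤ) * (A - 1ℤ) - n * (A * A)) - A * ((A - 1ℤ) * (A - 1ℤ) - n))
          + ((A - 1ℤ) * (A - 1ℤ) - n * (A * A)) * (U - A - 0ℤ)
      U≈A⇒ = solve-∀
      UA≈1⇒ : ∀ U A n → (A - 1ℤ) * (A - 1ℤ) * ((A - 1ℤ) * (A + 1ℤ)) - 0ℤ
        ≡ - A * (U * ((A - 1ℤ) * (A - 1ℤ) - n * (A * A)) - A * ((A - 1ℤ) * (A - 1ℤ) - n))
          + ((A - 1ℤ) * (A - 1ℤ) - n * (A * A)) * (U * A - 1ℤ - 0ℤ)
      UA≈1⇒ = solve-∀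

  -- For a = -1 and n = 4 the equation reads U · 0 ≈ 0: every U except 0 and -1 is admissible.
  special-fiber : ∀ {U A} → A ≈ - 1ℤ → n ≈ + 4 → Member U A ⇔ (U ≉ 0ℤ × U ≉ - 1ℤ)
  special-fiber {U} {A} A≈-1 n≈4 = mk⇔ to from
    where
    to : Member U A → U ≉ 0ℤ × U ≉ - 1ℤ
    to m = Member.U≉0 m , λ U≈-1 → Member.U≉A m (≈-trans U≈-1 (≈-sym A≈-1))
    4-n≈0 : + 4 - n ≈ 0ℤ
    4-n≈0 = ≈⇒-≈0 (≈-sym n≈4)
    from : U ≉ 0ℤ × U ≉ - 1ℤ → Member U A
    from (U≉0 , U≉-1) = record
      { U≉0 = U≉0
      ; A≉0 = λ A≈0 → 1≉0 (combine (- 1ℤ) (≈-trans (≈-sym A≈-1) A≈0) refl)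
      ; A≉1 = λ A≈1 → 2≉0 (combine (- 1ℤ) (≈-trans (≈-sym A≈-1) A≈1) refl)
      ; U≉A = λ U≈A → U≉-1 (≈-trans U≈A A≈-1)
      ; UA≉1 = λ UA≈1 → U≉-1 (combine (- 1ℤ) (≈-trans (≈-sym (*-cong (≈-refl {U}) A≈-1)) UA≈1) (identity U))
      ; linear = begin
          U * K A    ≈⟨ *-cong (≈-refl {U}) (≈-trans (K-at-−1 A≈-1) 4-n≈0) ⟩
          U * 0ℤ     ≡⟨ zero-both U A ⟩
          A * 0ℤ     ≈⟨ *-cong (≈-refl {A}) (≈-sym (≈-trans (Q-at-−1 A≈-1) 4-n≈0)) ⟩
          A * Q A    ∎
      }
      where
      open ≈-Reasoning
      identity : ∀ U → U - - 1ℤ ≡ - 1ℤ * (U * - 1ℤ - 1ℤ)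
      identity = solve-∀
      zero-both : ∀ U A → U * 0ℤ ≡ A * 0ℤ
      zero-both = solve-∀

-- Counting S(N) fiber by fiber: for each a, the number of admissible u.
module Fibers (p : ℕ) (pr : Prime p) (p>3 : 3 < p) (N : ℕ)
              (N≢0 : _%_ N p {{prime⇒nonZero pr}} ≢ 0) where
  open import Data.Nat as ℕ using (ℕ)
  open import Data.Nat.DivMod using (_%_)
  open import Data.Nat.Primality using (Prime; prime⇒nonZero)
  open import Relation.Binary.PropositionalEquality using (_≡_; _≢_)
  open Congruence p pr
  import Data.Nat.Properties as ℕP
  open import Data.Nat.DivMod using (m<n⇒m%n≡m; m%n%n≡m%n; m%n<n)
  open import Data.Integer using (ℤ; +_; _*_; _-_; -_; 0ℤ; 1ℤ)
  open import Data.Fin using (Fin; toℕ; fromℕ<)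
  open import Data.Fin.Properties using (toℕ<n; toℕ-injective; toℕ-fromℕ<)
  open import Data.List using (List; []; _∷_; map; length)
  open import Data.List.Properties using (length-map)
  open import Data.List.Relation.Unary.Any using (Any; here; there)
  import Data.List.Relation.Unary.Any as Any
  import Data.List.Relation.Unary.Any.Properties as Any
  open import Data.List.Relation.Unary.All using ([]; _∷_)
  import Data.List.Relation.Unary.All as All
  import Data.List.Relation.Unary.All.Properties as All
  open import Data.List.Relation.Unary.AllPairs using (AllPairs; []; _∷_)
  import Data.List.Relation.Unary.AllPairs as AllPairs
  import Data.List.Relation.Unary.AllPairs.Properties as AllPairs
  open import Data.List.Relation.Unary.Unique.Propositional using (Unique)
  open import Data.List.Membership.Propositional using (_∈_; _∉_)
  open import Data.List.Membership.DecPropositional ℕP._≟_ using (_∈?_; _∉?_)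
  open import Data.Product using (_×_; _,_; proj₁; proj₂)
  open import Function using (_∘_; _⇔_; mk⇔; Equivalence)
  open import Function.Properties.Equivalence using () renaming (trans to ⇔-trans; sym to ⇔-sym)
  open import Relation.Nullary using (¬_; Dec; yes; no)
  open import Relation.Binary.PropositionalEquality using (refl; sym; trans; cong; cong₂; module ≡-Reasoning)
  open import Algebra.Properties.Semiring.Sum ℕP.+-*-semiring using (sum-syntax; sum-cong-≗; ∑-distrib-+)
  open import Defs using (module Fp)
  open Fp p using (InS; InS?; cardS; _⊗_; _⊖_; inv)
  open Counting

  n : ℤ
  n = + N

  0<p : 0 ℕ.< p
  0<p = ℕP.≤-<-trans ℕ.z≤n p>3

  n≉0 : n ≉ 0ℤ
  n≉0 n≈0 = N≢0 (trans (≈⇒%≡ n≈0) (m<n⇒m%n≡m 0<p))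

  open Condition p pr p>3 n n≉0

  ≢⇔≉ : ∀ {x y} → x ℕ.< p → y ℕ.< p → x ≢ y ⇔ + x ≉ + y
  ≢⇔≉ x<p y<p = mk⇔ (λ x≢y x≈y → x≢y (≈⇒≡ x<p y<p x≈y)) (λ x≉y x≡y → x≉y (≡⇒≈ (cong +_ x≡y)))

  lhs : ℕ → ℕ → ℕ
  lhs u a = inv ((u ⊗ a) ⊖ 1) ⊗ ((u ⊗ inv a) ⊖ 1) ⊗ ((a ⊖ 1) ⊗ (a ⊖ 1))

  lhs≈L : ∀ u a → + lhs u a ≈ L (+ u) (+ a)
  lhs≈L u a = begin
    + lhs u a                        ≈⟨ ⊗-≈ (inv x₁ ⊗ x₂) x₃ ⟩
    + (inv x₁ ⊗ x₂) * + x₃           ≈⟨ *-cong (⊗-≈ (inv x₁) x₂) (≈-refl {+ x₃}) ⟩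
    + inv x₁ * + x₂ * + x₃           ≈⟨ *-cong (*-cong first second) third ⟩
    L (+ u) (+ a)                    ∎
    where
    open ≈-Reasoning
    x₁ x₂ x₃ : ℕ
    x₁ = (u ⊗ a) ⊖ 1
    x₂ = (u ⊗ inv a) ⊖ 1
    x₃ = (a ⊖ 1) ⊗ (a ⊖ 1)
    first : + inv x₁ ≈ iv (+ u * + a - 1ℤ)
    first = ≈-trans (inv-≈ x₁) (iv-cong (≈-trans (⊖-≈ (u ⊗ a) 1) (-‿cong (⊗-≈ u a) (≈-refl {1ℤ}))))
    second : + x₂ ≈ + u * iv (+ a) - 1ℤ
    second = ≈-trans (⊖-≈ (u ⊗ inv a) 1)
               (-‿cong (≈-trans (⊗-≈ u (inv a)) (*-cong (≈-refl {+ u}) (inv-≈ a))) (≈-refl {1ℤ}))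
    third : + x₃ ≈ (+ a - 1ℤ) * (+ a - 1ℤ)
    third = ≈-trans (⊗-≈ (a ⊖ 1) (a ⊖ 1)) (*-cong (⊖-≈ a 1) (⊖-≈ a 1))

  lhs≡N⇔ : ∀ u a → lhs u a ≡ N % p ⇔ L (+ u) (+ a) ≈ n
  lhs≡N⇔ u a = mk⇔
    (λ lhs≡ → ≈-trans (≈-sym (lhs≈L u a)) (≈-trans (≡⇒≈ (cong +_ lhs≡)) (%-≈ N)))
    (λ L≈n → trans (sym (m%n%n≡m%n _ p)) (≈⇒%≡ (≈-trans (lhs≈L u a) L≈n)))

  ≢inv⇔ : ∀ u a → u ℕ.< p → + a ≉ 0ℤ → u ≢ inv a ⇔ + u * + a ≉ 1ℤ
  ≢inv⇔ u a u<p A≉0 = mk⇔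
    (λ u≢a⁻¹ UA≈1 → u≢a⁻¹ (≈⇒≡ u<p (m%n<n _ p) (≈-trans (*≈1⇒≈iv A≉0 UA≈1) (≈-sym (inv-≈ a)))))
    (λ UA≉1 u≡a⁻¹ → UA≉1 (≈iv⇒*≈1 A≉0 (≈-trans (≡⇒≈ (cong +_ u≡a⁻¹)) (inv-≈ a))))

  InS⇔Member : ∀ u a → InS N (u , a) ⇔ Member (+ toℕ u) (+ toℕ a)
  InS⇔Member u a = mk⇔ to from
    where
    u<p : toℕ u ℕ.< p
    u<p = toℕ<n u
    a<p : toℕ a ℕ.< p
    a<p = toℕ<n a
    1<p : 1 ℕ.< p
    1<p = ≤3⇒<p (ℕ.s≤s ℕ.z≤n)
    to : InS N (u , a) → Member (+ toℕ u) (+ toℕ a)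
    to (u≢0 , a≢0 , a≢1 , u≢a , u≢a⁻¹ , lhs≡N) = record
      { U≉0 = Equivalence.to (≢⇔≉ u<p 0<p) u≢0
      ; A≉0 = A≉0
      ; A≉1 = Equivalence.to (≢⇔≉ a<p 1<p) a≢1
      ; U≉A = Equivalence.to (≢⇔≉ u<p a<p) u≢a
      ; UA≉1 = UA≉1
      ; linear = proj₂ (Equivalence.to (L≈n⇔ (+ toℕ u) (+ toℕ a) A≉0) (Equivalence.to (lhs≡N⇔ (toℕ u) (toℕ a)) lhs≡N))
      }
      where
      A≉0 : + toℕ a ≉ 0ℤ
      A≉0 = Equivalence.to (≢⇔≉ a<p 0<p) a≢0
      UA≉1 : + toℕ u * + toℕ a ≉ 1ℤ
      UA≉1 = Equivalence.to (≢inv⇔ (toℕ u) (toℕ a) u<p A≉0) u≢a⁻¹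
    from : Member (+ toℕ u) (+ toℕ a) → InS N (u , a)
    from m = Equivalence.from (≢⇔≉ u<p 0<p) U≉0
           , Equivalence.from (≢⇔≉ a<p 0<p) A≉0
           , Equivalence.from (≢⇔≉ a<p 1<p) A≉1
           , Equivalence.from (≢⇔≉ u<p a<p) U≉A
           , Equivalence.from (≢inv⇔ (toℕ u) (toℕ a) u<p A≉0) UA≉1
           , Equivalence.from (lhs≡N⇔ (toℕ u) (toℕ a)) (Equivalence.from (L≈n⇔ (+ toℕ u) (+ toℕ a) A≉0) (UA≉1 , linear))
      where open Member m

  fiber : Fin p → ℕ
  fiber a = ∑[ u < p ] ind (InS? N (u , a))

  cardS≡∑fiber : cardS N ≡ ∑[ a < p ] fiber a
  cardS≡∑fiber = count-pairs (InS? N)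

  reps : List ℤ → List ℕ
  reps = map rep

  rep-injective : ∀ {x y} → rep x ≡ rep y → x ≈ y
  rep-injective {x} {y} rx≡ry = ≈-trans (≈-sym (rep-≈ x)) (≈-trans (≡⇒≈ (cong +_ rx≡ry)) (rep-≈ y))

  ∈-reps⇔ : ∀ (a : Fin p) zs → toℕ a ∈ reps zs ⇔ Any (+ toℕ a ≈_) zs
  ∈-reps⇔ a zs = mk⇔ (Any.map to ∘ Any.map⁻) (Any.map⁺ ∘ Any.map from)
    where
    to : ∀ {z} → toℕ a ≡ rep z → + toℕ a ≈ z
    to {z} a≡rz = ≈-trans (≡⇒≈ (cong +_ a≡rz)) (rep-≈ z)
    from : ∀ {z} → + toℕ a ≈ z → toℕ a ≡ rep z
    from {z} A≈z = ≈⇒≡ (toℕ<n a) (rep<p z) (≈-trans A≈z (≈-sym (rep-≈ z)))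

  count-avoiding : ∀ zs → AllPairs _≉_ zs → ∑[ u < p ] ind (toℕ u ∉? reps zs) ≡ p ℕ.∸ length zs
  count-avoiding zs distinct = trans (count-outside p (reps zs) unique (All.map⁺ (All.universal rep<p zs)))
                                     (cong (p ℕ.∸_) (length-map rep zs))
    where
    unique : Unique (reps zs)
    unique = AllPairs.map⁺ (AllPairs.map (λ z≉z' rz≡rz' → z≉z' (rep-injective rz≡rz')) distinct)

  ⟦_⟧ : Fin p → ℤ
  ⟦ a ⟧ = + toℕ a

  fiber-generic : ∀ a → ¬ Degenerate ⟦ a ⟧ → fiber a ≡ 1
  fiber-generic a nondegenerate =
    trans (sum-cong-≗ {p} (λ u → ind-⇔ (InS? N (u , a)) (toℕ u ℕP.≟ rep W) (unique-u u)))
          (count-point (rep W) (rep<p W))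
    where
    W : ℤ
    W = ⟦ a ⟧ * Q ⟦ a ⟧ * iv (K ⟦ a ⟧)
    unique-u : ∀ u → InS N (u , a) ⇔ toℕ u ≡ rep W
    unique-u u = mk⇔
      (λ ins → ≈⇒≡ (toℕ<n u) (rep<p W) (≈-trans (Equivalence.to (generic-fiber nondegenerate)
                                                    (Equivalence.to (InS⇔Member u a) ins)) (≈-sym (rep-≈ W))))
      (λ u≡ → Equivalence.from (InS⇔Member u a) (Equivalence.from (generic-fiber nondegenerate)
                                                    (≈-trans (≡⇒≈ (cong +_ u≡)) (rep-≈ W))))

  fiber-degenerate : ∀ a → Degenerate ⟦ a ⟧ → ¬ (⟦ a ⟧ ≈ - 1ℤ × n ≈ + 4) → fiber a ≡ 0
  fiber-degenerate a degenerate not-special =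
    trans (sum-cong-≗ {p} (λ u → ind-no (InS? N (u , a))
                                   (degenerate-fiber degenerate not-special ∘ Equivalence.to (InS⇔Member u a))))
          (∑-zeros p)

  fiber-special : ∀ a → ⟦ a ⟧ ≈ - 1ℤ → n ≈ + 4 → fiber a ≡ p ℕ.∸ 2
  fiber-special a a≈-1 n≈4 =
    trans (sum-cong-≗ {p} (λ u → ind-⇔ (InS? N (u , a)) (toℕ u ∉? reps excluded) (admissible u)))
          (count-avoiding excluded ((0≉-1 ∷ []) ∷ [] ∷ []))
    where
    excluded : List ℤ
    excluded = 0ℤ ∷ - 1ℤ ∷ []
    admissible : ∀ u → InS N (u , a) ⇔ (toℕ u ∉ reps excluded)
    admissible u = mk⇔
      (λ ins → let (U≉0 , U≉-1) = Equivalence.to (special-fiber a≈-1 n≈4) (Equivalence.to (InS⇔Member u a) ins)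
               in λ u∈ → excluded-by U≉0 U≉-1 (Equivalence.to (∈-reps⇔ u excluded) u∈))
      (λ u∉ → Equivalence.from (InS⇔Member u a) (Equivalence.from (special-fiber a≈-1 n≈4)
                 ((λ U≈0 → u∉ (Equivalence.from (∈-reps⇔ u excluded) (here U≈0)))
                 , (λ U≈-1 → u∉ (Equivalence.from (∈-reps⇔ u excluded) (there (here U≈-1)))))))
      where
      excluded-by : ⟦ u ⟧ ≉ 0ℤ → ⟦ u ⟧ ≉ - 1ℤ → ¬ Any (⟦ u ⟧ ≈_) excluded
      excluded-by U≉0 U≉-1 (here U≈0)          = U≉0 U≈0
      excluded-by U≉0 U≉-1 (there (here U≈-1)) = U≉-1 U≈-1

  a₋₁ : Fin p
  a₋₁ = fromℕ< (rep<p (- 1ℤ))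

  -- If the degenerate values are exactly those congruent to an element of
  -- the pairwise incongruent list zs, then |S(N)| = (p - |zs|) + fiber(-1):
  -- every nondegenerate a contributes 1, every degenerate a ≠ -1 contributes 0.
  cardS-formula : ∀ zs → AllPairs _≉_ zs → (∀ A → Degenerate A ⇔ Any (A ≈_) zs) →
                  cardS N ≡ p ℕ.∸ length zs ℕ.+ fiber a₋₁
  cardS-formula zs distinct degenerate⇔ = begin
    cardS N                                                          ≡⟨ cardS≡∑fiber ⟩
    ∑[ a < p ] fiber a                                               ≡⟨ sum-cong-≗ {p} split ⟩
    ∑[ a < p ] (ind (toℕ a ∉? reps zs) ℕ.+ ind (toℕ a ℕP.≟ r) ℕ.* fiber a₋₁)
                                                                     ≡⟨ ∑-distrib-+ {p} (λ a → ind (toℕ a ∉? reps zs)) _ ⟩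
    ∑[ a < p ] ind (toℕ a ∉? reps zs) ℕ.+ ∑[ a < p ] (ind (toℕ a ℕP.≟ r) ℕ.* fiber a₋₁)
                                                                     ≡⟨ cong₂ ℕ._+_ (count-avoiding zs distinct)
                                                                                 (count-point-weighted r (fiber a₋₁) (rep<p (- 1ℤ))) ⟩
    p ℕ.∸ length zs ℕ.+ fiber a₋₁                                    ∎
    where
    open ≡-Reasoning
    r : ℕ
    r = rep (- 1ℤ)
    degenerate⇔∈ : ∀ a → Degenerate ⟦ a ⟧ ⇔ toℕ a ∈ reps zs
    degenerate⇔∈ a = ⇔-trans (degenerate⇔ ⟦ a ⟧) (⇔-sym (∈-reps⇔ a zs))
    split : ∀ a → fiber a ≡ ind (toℕ a ∉? reps zs) ℕ.+ ind (toℕ a ℕP.≟ r) ℕ.* fiber a₋₁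
    split a with toℕ a ℕP.≟ r
    ... | yes a≡r = begin
      fiber a                                      ≡⟨ cong fiber (toℕ-injective (trans a≡r (sym (toℕ-fromℕ< _)))) ⟩
      fiber a₋₁                                    ≡⟨ sym (ℕP.+-identityʳ (fiber a₋₁)) ⟩
      0 ℕ.+ 1 ℕ.* fiber a₋₁                        ≡⟨ cong (ℕ._+ 1 ℕ.* fiber a₋₁) (sym (ind-no (toℕ a ∉? reps zs) (λ a∉ → a∉ a∈))) ⟩
      ind (toℕ a ∉? reps zs) ℕ.+ 1 ℕ.* fiber a₋₁   ∎
      where
      a≈-1 : ⟦ a ⟧ ≈ - 1ℤ
      a≈-1 = ≈-trans (≡⇒≈ (cong +_ a≡r)) (rep-≈ (- 1ℤ))
      a∈ : toℕ a ∈ reps zs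
      a∈ = Equivalence.to (degenerate⇔∈ a) (at-−1 a≈-1)
    ... | no a≢r = trans (outside-or-not (toℕ a ∈? reps zs)) (sym (ℕP.+-identityʳ _))
      where
      a≉-1 : ⟦ a ⟧ ≉ - 1ℤ
      a≉-1 a≈-1 = a≢r (≈⇒≡ (toℕ<n a) (rep<p (- 1ℤ)) (≈-trans a≈-1 (≈-sym (rep-≈ (- 1ℤ)))))
      outside-or-not : Dec (toℕ a ∈ reps zs) → fiber a ≡ ind (toℕ a ∉? reps zs)
      outside-or-not (yes a∈) =
        trans (fiber-degenerate a (Equivalence.from (degenerate⇔∈ a) a∈) (a≉-1 ∘ proj₁))
              (sym (ind-no (toℕ a ∉? reps zs) (λ a∉ → a∉ a∈)))
      outside-or-not (no a∉) =
        trans (fiber-generic a (a∉ ∘ Equivalence.to (degenerate⇔∈ a))) (sym (ind-yes (toℕ a ∉? reps zs) a∉))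

  a₋₁≈-1 : ⟦ a₋₁ ⟧ ≈ - 1ℤ
  a₋₁≈-1 = ≈-trans (≡⇒≈ (cong +_ (toℕ-fromℕ< (rep<p (- 1ℤ))))) (rep-≈ (- 1ℤ))

  fiber-−1 : n ≉ + 4 → fiber a₋₁ ≡ 0
  fiber-−1 n≉4 = fiber-degenerate a₋₁ (at-−1 a₋₁≈-1) (n≉4 ∘ proj₂)

  fiber-−1[n≈4] : n ≈ + 4 → fiber a₋₁ ≡ p ℕ.∸ 2
  fiber-−1[n≈4] = fiber-special a₋₁ a₋₁≈-1

-- The degenerate values of a, listed explicitly, according to whether n
-- is a square in F_p.
module Cases (p : ℕ) (pr : Prime p) (p>3 : 3 < p) (N : ℕ)
             (N≢0 : _%_ N p {{prime⇒nonZero pr}} ≢ 0) where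
  open import Data.Nat as ℕ using (ℕ)
  open import Data.Nat.DivMod using (_%_; m%n%n≡m%n)
  open import Data.Nat.Primality using (Prime; prime⇒nonZero)
  open import Relation.Binary.PropositionalEquality using (_≡_; _≢_)
  open Congruence p pr
  open Fibers p pr p>3 N N≢0
  open Condition p pr p>3 n n≉0
  open import Data.Integer using (ℤ; +_; _+_; _*_; _-_; -_; 0ℤ; 1ℤ)
  import Data.Integer.Properties as ℤP
  import Data.Nat.Properties as ℕP
  open import Data.Integer.Tactic.RingSolver using (solve-∀)
  open import Data.Fin using (toℕ; fromℕ<)
  open import Data.Fin.Properties using (toℕ-fromℕ<)
  open import Data.List using (List; []; _∷_)
  open import Data.List.Relation.Unary.Any using (Any; here; there)
  import Data.List.Relation.Unary.Any as Any
  open import Data.List.Relation.Unary.All using (All; []; _∷_)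
  open import Data.List.Relation.Unary.AllPairs using (AllPairs; []; _∷_)
  open import Data.Product using (_,_)
  open import Data.Sum using (_⊎_; inj₁; inj₂)
  import Data.Sum as Sum
  open import Data.Empty using (⊥; ⊥-elim)
  open import Function using (_∘_; _⇔_; mk⇔; Equivalence)
  open import Relation.Nullary using (¬_)
  open import Relation.Binary.PropositionalEquality using (refl; sym; trans; cong; module ≡-Reasoning)
  open import Defs using (module Fp)
  open Fp p using (IsNonzeroSquare; cardS; _⊗_)
  open Equivalence using (to; from)

  degenerate-list : ∀ zs → Any (0ℤ ≈_) zs → Any (1ℤ ≈_) zs → Any (- 1ℤ ≈_) zs →
                    (∀ {A} → Q A ≈ 0ℤ → Any (A ≈_) zs) → (∀ {A} → K A ≈ 0ℤ → Any (A ≈_) zs) →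
                    All Degenerate zs → ∀ A → Degenerate A ⇔ Any (A ≈_) zs
  degenerate-list zs 0∈ 1∈ -1∈ Q-roots∈ K-roots∈ all-degenerate A = mk⇔ listed degenerate
    where
    listed : Degenerate A → Any (A ≈_) zs
    listed (at-0 A≈0)   = Any.map (≈-trans A≈0) 0∈
    listed (at-1 A≈1)   = Any.map (≈-trans A≈1) 1∈
    listed (at-−1 A≈-1) = Any.map (≈-trans A≈-1) -1∈
    listed (K-root K≈0) = K-roots∈ K≈0
    listed (Q-root Q≈0) = Q-roots∈ Q≈0
    degenerate-at : ∀ {zs} → All Degenerate zs → Any (A ≈_) zs → Degenerate A
    degenerate-at (d ∷ _)  (here A≈z)  = Degenerate-resp (≈-sym A≈z) d
    degenerate-at (_ ∷ ds) (there A∈) = degenerate-at ds A∈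
    degenerate : Any (A ≈_) zs → Degenerate A
    degenerate = degenerate-at all-degenerate

  apart : ∀ {x y} c k → c ≉ 0ℤ → c - 0ℤ ≡ k * (x - y) → x ≉ y
  apart c k c≉0 identity x≈y = c≉0 (combine k x≈y identity)

  apart-iv : ∀ {x w} → w ≉ 0ℤ → x * w ≉ 1ℤ → x ≉ iv w
  apart-iv w≉0 xw≉1 = xw≉1 ∘ ≈iv⇒*≈1 w≉0

  4≉0 : + 4 ≉ 0ℤ
  4≉0 = *-nonzero {+ 2} {+ 2} 2≉0 2≉0

  nonzero-square : ∀ y → y * y ≈ n → IsNonzeroSquare N
  nonzero-square y y²≈n = N≢0 , fromℕ< (rep<p y) , (begin
    toℕ (fromℕ< (rep<p y)) ⊗ toℕ (fromℕ< (rep<p y))   ≡⟨ cong (λ t → t ⊗ t) (toℕ-fromℕ< (rep<p y)) ⟩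
    rep y ⊗ rep y                                     ≡⟨ sym (m%n%n≡m%n _ p) ⟩
    (rep y ⊗ rep y) % p                               ≡⟨ ≈⇒%≡ (≈-trans (⊗-≈ (rep y) (rep y)) (≈-trans (*-cong (rep-≈ y) (rep-≈ y)) y²≈n)) ⟩
    N % p                                             ∎)
    where open ≡-Reasoning

  -- If n is not a square, Q and K have no roots:
  -- Q(A) ≈ 0 gives n ≈ (A-1)², and K(A) ≈ 0 (where A ≉ 0 as K(0) ≉ 0)
  -- gives n ≈ ((A-1)/A)².  Only 0, 1, -1 are degenerate.
  module NonSquare (nonsquare : ¬ IsNonzeroSquare N) where

    no-Q-root : ∀ {A} → Q A ≉ 0ℤ
    no-Q-root {A} Q≈0 = nonsquare (nonzero-square (A - 1ℤ) (-≈0⇒≈ Q≈0))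

    no-K-root : ∀ {A} → K A ≉ 0ℤ
    no-K-root {A} K≈0 = nonsquare (nonzero-square ((A - 1ℤ) * iv A)
      (combine₂ (iv A * iv A) (n * (A * iv A + 1ℤ)) K≈0 (inverse A A≉0) (identity A (iv A) n)))
      where
      A≉0 : A ≉ 0ℤ
      A≉0 A≈0 = K[0]≉0 (≈-trans (K-cong (≈-sym A≈0)) K≈0)
      identity : ∀ A a n → (A - 1ℤ) * a * ((A - 1ℤ) * a) - n
        ≡ a * a * ((A - 1ℤ) * (A - 1ℤ) - n * (A * A) - 0ℤ) + n * (A * a + 1ℤ) * (A * a - 1ℤ)
      identity = solve-∀

    degenerate⇔ : ∀ A → Degenerate A ⇔ Any (A ≈_) (0ℤ ∷ 1ℤ ∷ - 1ℤ ∷ [])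
    degenerate⇔ = degenerate-list _ (here ≈-refl) (there (here ≈-refl)) (there (there (here ≈-refl)))
                    (λ {A} → ⊥-elim ∘ no-Q-root {A}) (λ {A} → ⊥-elim ∘ no-K-root {A})
                    (at-0 ≈-refl ∷ at-1 ≈-refl ∷ at-−1 ≈-refl ∷ [])

    count : cardS N ≡ p ℕ.∸ 3
    count = begin
      cardS N                   ≡⟨ cardS-formula _ ((0≉1 ∷ 0≉-1 ∷ []) ∷ (1≉-1 ∷ []) ∷ [] ∷ []) degenerate⇔ ⟩
      p ℕ.∸ 3 ℕ.+ fiber a₋₁     ≡⟨ cong (p ℕ.∸ 3 ℕ.+_) (fiber-−1 (nonsquare ∘ nonzero-square (+ 2) ∘ ≈-sym)) ⟩
      p ℕ.∸ 3 ℕ.+ 0             ≡⟨ ℕP.+-identityʳ _ ⟩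
      p ℕ.∸ 3                   ∎
      where open ≡-Reasoning

  module Square (S : ℤ) (S²≈n : S * S ≈ n) where

    Q-factor : ∀ A → Q A ≈ (A - (1ℤ + S)) * (A - (1ℤ - S))
    Q-factor A = combine 1ℤ S²≈n (identity A S n)
      where
      identity : ∀ A S n → (A - 1ℤ) * (A - 1ℤ) - n - (A - (1ℤ + S)) * (A - (1ℤ - S)) ≡ 1ℤ * (S * S - n)
      identity = solve-∀

    K-factor : ∀ A → K A ≈ (A * (1ℤ - S) - 1ℤ) * (A * (1ℤ + S) - 1ℤ)
    K-factor A = combine (A * A) S²≈n (identity A S n)
      where
      identity : ∀ A S n → (A - 1ℤ) * (A - 1ℤ) - n * (A * A) - (A * (1ℤ - S) - 1ℤ) * (A * (1ℤ + S) - 1ℤ)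
                           ≡ A * A * (S * S - n)
      identity = solve-∀

    Q-root⇔ : ∀ A → Q A ≈ 0ℤ ⇔ (A ≈ 1ℤ + S ⊎ A ≈ 1ℤ - S)
    Q-root⇔ A = mk⇔
      (λ Q≈0 → Sum.map -≈0⇒≈ -≈0⇒≈ (integral _ _ (≈-trans (≈-sym (Q-factor A)) Q≈0)))
      (λ A≈ → ≈-trans (Q-factor A) (from (*≈0⇔ _ _) (Sum.map ≈⇒-≈0 ≈⇒-≈0 A≈)))

    K-root⇔ : ∀ A → K A ≈ 0ℤ ⇔ (A * (1ℤ - S) ≈ 1ℤ ⊎ A * (1ℤ + S) ≈ 1ℤ)
    K-root⇔ A = mk⇔
      (λ K≈0 → Sum.map -≈0⇒≈ -≈0⇒≈ (integral _ _ (≈-trans (≈-sym (K-factor A)) K≈0)))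
      (λ A≈ → ≈-trans (K-factor A) (from (*≈0⇔ _ _) (Sum.map ≈⇒-≈0 ≈⇒-≈0 A≈)))

    Q[1+S]≈0 : Q (1ℤ + S) ≈ 0ℤ
    Q[1+S]≈0 = from (Q-root⇔ _) (inj₁ ≈-refl)

    Q[1-S]≈0 : Q (1ℤ - S) ≈ 0ℤ
    Q[1-S]≈0 = from (Q-root⇔ _) (inj₂ ≈-refl)

    -- n a square different from 1 and 4: the seven values
    -- 0, 1, -1, 1+S, 1-S, (1-S)⁻¹, (1+S)⁻¹ are distinct and degenerate.
    module Generic (n≉1 : n ≉ 1ℤ) (n≉4 : n ≉ + 4) where

      S≉0 : S ≉ 0ℤ
      S≉0 S≈0 = n≉0 (≈-trans (≈-sym S²≈n) (*-cong S≈0 S≈0))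

      1-S≉0 : 1ℤ - S ≉ 0ℤ
      1-S≉0 e = n≉1 (≈-trans (≈-sym S²≈n) (*-cong S≈1 S≈1))
        where
        S≈1 : S ≈ 1ℤ
        S≈1 = ≈-sym (-≈0⇒≈ e)

      1+S≉0 : 1ℤ + S ≉ 0ℤ
      1+S≉0 e = n≉1 (≈-trans (≈-sym S²≈n) (*-cong S≈-1 S≈-1))
        where
        identity : ∀ S → S - - 1ℤ ≡ 1ℤ * (1ℤ + S - 0ℤ)
        identity = solve-∀
        S≈-1 : S ≈ - 1ℤ
        S≈-1 = combine 1ℤ e (identity S)

      -- Values of Q and K at 0, 1, -1 are 1 - n, -n, 4 - n and 1, -n, 4 - n.
      Q[0]≉0 : Q 0ℤ ≉ 0ℤ
      Q[0]≉0 e = n≉1 (≈-sym (-≈0⇒≈ e))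

      Q[1]≉0 : Q 1ℤ ≉ 0ℤ
      Q[1]≉0 e = n≉0 (≈-sym (-≈0⇒≈ e))

      Q[-1]≉0 : Q (- 1ℤ) ≉ 0ℤ
      Q[-1]≉0 e = n≉4 (≈-sym (-≈0⇒≈ (≈-trans (≈-sym (Q-at-−1 ≈-refl)) e)))

      K[1]≉0 : K 1ℤ ≉ 0ℤ
      K[1]≉0 e = n≉0 (combine (- 1ℤ) e (identity n))
        where
        identity : ∀ n → n - 0ℤ ≡ - 1ℤ * ((1ℤ - 1ℤ) * (1ℤ - 1ℤ) - n * (1ℤ * 1ℤ) - 0ℤ)
        identity = solve-∀

      K[-1]≉0 : K (- 1ℤ) ≉ 0ℤ
      K[-1]≉0 e = n≉4 (≈-sym (-≈0⇒≈ (≈-trans (≈-sym (K-at-−1 ≈-refl)) e)))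

      apart-Q-root : ∀ c {z} → Q c ≉ 0ℤ → Q z ≈ 0ℤ → c ≉ z
      apart-Q-root c Qc≉0 Qz≈0 c≈z = Qc≉0 (≈-trans (Q-cong c≈z) Qz≈0)

      apart-K-root : ∀ c {z} → K c ≉ 0ℤ → K z ≈ 0ℤ → c ≉ z
      apart-K-root c Kc≉0 Kz≈0 c≈z = Kc≉0 (≈-trans (K-cong c≈z) Kz≈0)

      -- Roots of Q and roots of K are apart: a common root lies in {0, 1, -1}.
      apart-Q-K : ∀ {x y} → Q x ≈ 0ℤ → K y ≈ 0ℤ → x ≉ y
      apart-Q-K {x} Qx≈0 Ky≈0 x≈y = excluded (common-root (≈-trans (K-cong x≈y) Ky≈0) Qx≈0)
        where
        excluded : x ≈ 0ℤ ⊎ x ≈ 1ℤ ⊎ x ≈ - 1ℤ → ⊥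
        excluded (inj₁ x≈0)         = apart-Q-root 0ℤ Q[0]≉0 Qx≈0 (≈-sym x≈0)
        excluded (inj₂ (inj₁ x≈1))  = apart-Q-root 1ℤ Q[1]≉0 Qx≈0 (≈-sym x≈1)
        excluded (inj₂ (inj₂ x≈-1)) = apart-Q-root (- 1ℤ) Q[-1]≉0 Qx≈0 (≈-sym x≈-1)

      k₁ k₂ : ℤ
      k₁ = iv (1ℤ - S)
      k₂ = iv (1ℤ + S)

      K[k₁]≈0 : K k₁ ≈ 0ℤ
      K[k₁]≈0 = from (K-root⇔ k₁) (inj₁ (≈iv⇒*≈1 1-S≉0 ≈-refl))

      K[k₂]≈0 : K k₂ ≈ 0ℤ
      K[k₂]≈0 = from (K-root⇔ k₂) (inj₂ (≈iv⇒*≈1 1+S≉0 ≈-refl))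

      1+S≉1-S : 1ℤ + S ≉ 1ℤ - S
      1+S≉1-S = apart (+ 2 * S) 1ℤ (*-nonzero 2≉0 S≉0) (identity S)
        where
        identity : ∀ S → + 2 * S - 0ℤ ≡ 1ℤ * (1ℤ + S - (1ℤ - S))
        identity = solve-∀

      degenerate-values : List ℤ
      degenerate-values = 0ℤ ∷ 1ℤ ∷ - 1ℤ ∷ 1ℤ + S ∷ 1ℤ - S ∷ k₁ ∷ k₂ ∷ []

      distinct : AllPairs _≉_ degenerate-values
      distinct =
          (0≉1 ∷ 0≉-1 ∷ apart-Q-root 0ℤ Q[0]≉0 Q[1+S]≈0 ∷ apart-Q-root 0ℤ Q[0]≉0 Q[1-S]≈0
               ∷ apart-K-root 0ℤ K[0]≉0 K[k₁]≈0 ∷ apart-K-root 0ℤ K[0]≉0 K[k₂]≈0 ∷ [])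
        ∷ (1≉-1 ∷ apart-Q-root 1ℤ Q[1]≉0 Q[1+S]≈0 ∷ apart-Q-root 1ℤ Q[1]≉0 Q[1-S]≈0
               ∷ apart-K-root 1ℤ K[1]≉0 K[k₁]≈0 ∷ apart-K-root 1ℤ K[1]≉0 K[k₂]≈0 ∷ [])
        ∷ (apart-Q-root (- 1ℤ) Q[-1]≉0 Q[1+S]≈0 ∷ apart-Q-root (- 1ℤ) Q[-1]≉0 Q[1-S]≈0
               ∷ apart-K-root (- 1ℤ) K[-1]≉0 K[k₁]≈0 ∷ apart-K-root (- 1ℤ) K[-1]≉0 K[k₂]≈0 ∷ [])
        ∷ (1+S≉1-S ∷ apart-Q-K Q[1+S]≈0 K[k₁]≈0 ∷ apart-Q-K Q[1+S]≈0 K[k₂]≈0 ∷ [])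
        ∷ (apart-Q-K Q[1-S]≈0 K[k₁]≈0 ∷ apart-Q-K Q[1-S]≈0 K[k₂]≈0 ∷ [])
        ∷ ((λ k₁≈k₂ → 1+S≉1-S (≈-sym (iv-injective 1-S≉0 1+S≉0 k₁≈k₂))) ∷ [])
        ∷ [] ∷ []

      Q-root∈ : ∀ {A} → Q A ≈ 0ℤ → Any (A ≈_) degenerate-values
      Q-root∈ {A} Q≈0 = listed (to (Q-root⇔ A) Q≈0)
        where
        listed : A ≈ 1ℤ + S ⊎ A ≈ 1ℤ - S → Any (A ≈_) degenerate-values
        listed (inj₁ A≈1+S) = there (there (there (here A≈1+S)))
        listed (inj₂ A≈1-S) = there (there (there (there (here A≈1-S))))

      K-root∈ : ∀ {A} → K A ≈ 0ℤ → Any (A ≈_) degenerate-values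
      K-root∈ {A} K≈0 = listed (to (K-root⇔ A) K≈0)
        where
        listed : A * (1ℤ - S) ≈ 1ℤ ⊎ A * (1ℤ + S) ≈ 1ℤ → Any (A ≈_) degenerate-values
        listed (inj₁ A[1-S]≈1) = there (there (there (there (there (here (*≈1⇒≈iv 1-S≉0 A[1-S]≈1))))))
        listed (inj₂ A[1+S]≈1) = there (there (there (there (there (there (here (*≈1⇒≈iv 1+S≉0 A[1+S]≈1)))))))

      degenerate⇔ : ∀ A → Degenerate A ⇔ Any (A ≈_) degenerate-values
      degenerate⇔ = degenerate-list degenerate-values (here ≈-refl) (there (here ≈-refl)) (there (there (here ≈-refl)))
        Q-root∈ K-root∈
        (at-0 ≈-refl ∷ at-1 ≈-refl ∷ at-−1 ≈-refl ∷ Q-root Q[1+S]≈0 ∷ Q-root Q[1-S]≈0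
          ∷ K-root K[k₁]≈0 ∷ K-root K[k₂]≈0 ∷ [])

      count : cardS N ≡ p ℕ.∸ 7
      count = begin
        cardS N                   ≡⟨ cardS-formula degenerate-values distinct degenerate⇔ ⟩
        p ℕ.∸ 7 ℕ.+ fiber a₋₁     ≡⟨ cong (p ℕ.∸ 7 ℕ.+_) (fiber-−1 n≉4) ⟩
        p ℕ.∸ 7 ℕ.+ 0             ≡⟨ ℕP.+-identityʳ _ ⟩
        p ℕ.∸ 7                   ∎
        where open ≡-Reasoning

  -- n = 1, i.e. S = 1: here 1 - S = 0, and the degenerate values are 0, 1, -1, 2, 1/2.
  module One (n≈1 : n ≈ 1ℤ) where
    open Square 1ℤ (≈-sym n≈1)

    degenerate-values : List ℤ
    degenerate-values = 0ℤ ∷ 1ℤ ∷ - 1ℤ ∷ + 2 ∷ iv (+ 2) ∷ []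

    distinct : AllPairs _≉_ degenerate-values
    distinct =
        (0≉1 ∷ 0≉-1 ∷ apart (+ 2) (- 1ℤ) 2≉0 refl ∷ apart-iv 2≉0 0≉1 ∷ [])
      ∷ (1≉-1 ∷ apart 1ℤ (- 1ℤ) 1≉0 refl ∷ apart-iv 2≉0 (apart 1ℤ 1ℤ 1≉0 refl) ∷ [])
      ∷ (apart (+ 3) (- 1ℤ) 3≉0 refl ∷ apart-iv 2≉0 (apart (+ 3) (- 1ℤ) 3≉0 refl) ∷ [])
      ∷ (apart-iv 2≉0 (apart (+ 3) 1ℤ 3≉0 refl) ∷ [])
      ∷ [] ∷ []

    Q-root∈ : ∀ {A} → Q A ≈ 0ℤ → Any (A ≈_) degenerate-values
    Q-root∈ {A} Q≈0 = listed (to (Q-root⇔ A) Q≈0)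
      where
      listed : A ≈ + 2 ⊎ A ≈ 0ℤ → Any (A ≈_) degenerate-values
      listed (inj₁ A≈2) = there (there (there (here A≈2)))
      listed (inj₂ A≈0) = here A≈0

    K-root∈ : ∀ {A} → K A ≈ 0ℤ → Any (A ≈_) degenerate-values
    K-root∈ {A} K≈0 = listed (to (K-root⇔ A) K≈0)
      where
      listed : A * 0ℤ ≈ 1ℤ ⊎ A * + 2 ≈ 1ℤ → Any (A ≈_) degenerate-values
      listed (inj₁ A·0≈1) = ⊥-elim (0≉1 (≈-trans (≡⇒≈ (sym (ℤP.*-zeroʳ A))) A·0≈1))
      listed (inj₂ A·2≈1) = there (there (there (there (here (*≈1⇒≈iv 2≉0 A·2≈1)))))

    degenerate⇔ : ∀ A → Degenerate A ⇔ Any (A ≈_) degenerate-values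
    degenerate⇔ = degenerate-list degenerate-values (here ≈-refl) (there (here ≈-refl)) (there (there (here ≈-refl)))
      Q-root∈ K-root∈
      (at-0 ≈-refl ∷ at-1 ≈-refl ∷ at-−1 ≈-refl ∷ Q-root Q[1+S]≈0
        ∷ K-root (from (K-root⇔ (iv (+ 2))) (inj₂ (≈iv⇒*≈1 2≉0 ≈-refl))) ∷ [])

    count : cardS N ≡ p ℕ.∸ 5
    count = begin
      cardS N                   ≡⟨ cardS-formula degenerate-values distinct degenerate⇔ ⟩
      p ℕ.∸ 5 ℕ.+ fiber a₋₁     ≡⟨ cong (p ℕ.∸ 5 ℕ.+_) (fiber-−1 (apart (+ 3) (- 1ℤ) 3≉0 refl ∘ ≈-trans (≈-sym n≈1))) ⟩
      p ℕ.∸ 5 ℕ.+ 0             ≡⟨ ℕP.+-identityʳ _ ⟩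
      p ℕ.∸ 5                   ∎
      where open ≡-Reasoning

  -- n = 4, i.e. S = 2: here 1 - S = -1, the degenerate values are 0, 1, -1, 3, 1/3,
  -- and the fiber over -1 is the exceptional one.
  module Four (n≈4 : n ≈ + 4) where
    open Square (+ 2) (≈-sym n≈4)

    8≉0 : + 8 ≉ 0ℤ
    8≉0 = *-nonzero {+ 2} {+ 4} 2≉0 4≉0

    degenerate-values : List ℤ
    degenerate-values = 0ℤ ∷ 1ℤ ∷ - 1ℤ ∷ + 3 ∷ iv (+ 3) ∷ []

    distinct : AllPairs _≉_ degenerate-values
    distinct =
        (0≉1 ∷ 0≉-1 ∷ apart (+ 3) (- 1ℤ) 3≉0 refl ∷ apart-iv 3≉0 0≉1 ∷ [])
      ∷ (1≉-1 ∷ apart (+ 2) (- 1ℤ) 2≉0 refl ∷ apart-iv 3≉0 (apart (+ 2) 1ℤ 2≉0 refl) ∷ [])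
      ∷ (apart (+ 4) (- 1ℤ) 4≉0 refl ∷ apart-iv 3≉0 (apart (+ 4) (- 1ℤ) 4≉0 refl) ∷ [])
      ∷ (apart-iv 3≉0 (apart (+ 8) 1ℤ 8≉0 refl) ∷ [])
      ∷ [] ∷ []

    Q-root∈ : ∀ {A} → Q A ≈ 0ℤ → Any (A ≈_) degenerate-values
    Q-root∈ {A} Q≈0 = listed (to (Q-root⇔ A) Q≈0)
      where
      listed : A ≈ + 3 ⊎ A ≈ - 1ℤ → Any (A ≈_) degenerate-values
      listed (inj₁ A≈3)  = there (there (there (here A≈3)))
      listed (inj₂ A≈-1) = there (there (here A≈-1))

    K-root∈ : ∀ {A} → K A ≈ 0ℤ → Any (A ≈_) degenerate-values
    K-root∈ {A} K≈0 = listed (to (K-root⇔ A) K≈0)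
      where
      identity : ∀ A → A - - 1ℤ ≡ - 1ℤ * (A * - 1ℤ - 1ℤ)
      identity = solve-∀
      listed : A * - 1ℤ ≈ 1ℤ ⊎ A * + 3 ≈ 1ℤ → Any (A ≈_) degenerate-values
      listed (inj₁ -A≈1)  = there (there (here (combine (- 1ℤ) -A≈1 (identity A))))
      listed (inj₂ A·3≈1) = there (there (there (there (here (*≈1⇒≈iv 3≉0 A·3≈1)))))

    degenerate⇔ : ∀ A → Degenerate A ⇔ Any (A ≈_) degenerate-values
    degenerate⇔ = degenerate-list degenerate-values (here ≈-refl) (there (here ≈-refl)) (there (there (here ≈-refl)))
      Q-root∈ K-root∈
      (at-0 ≈-refl ∷ at-1 ≈-refl ∷ at-−1 ≈-refl ∷ Q-root Q[1+S]≈0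
        ∷ K-root (from (K-root⇔ (iv (+ 3))) (inj₂ (≈iv⇒*≈1 3≉0 ≈-refl))) ∷ [])

    count : cardS N ≡ p ℕ.∸ 5 ℕ.+ (p ℕ.∸ 2)
    count = trans (cardS-formula degenerate-values distinct degenerate⇔) (cong (p ℕ.∸ 5 ℕ.+_) (fiber-−1[n≈4] n≈4))

open import Defs
open import Data.Nat using (ℕ; _<_; _*_; _∸_; NonZero)
open import Data.Nat.DivMod using (_%_)
open import Data.Nat.Primality using (Prime)
open import Data.Product using (_×_)
open import Relation.Binary.PropositionalEquality using (_≡_; _≢_)
open import Relation.Nullary using (¬_)

open import Data.Nat using (_+_; s≤s; z≤n)
open import Data.Nat.Properties using (≤∧≢⇒<; <-trans)
open import Data.Nat.DivMod using (m<n⇒m%n≡m)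
open import Data.Nat.Tactic.RingSolver using (solve-∀)
open import Data.Integer as ℤ using (+_; 0ℤ)
open import Data.Fin using (toℕ)
open import Data.Product using (_,_)
open import Function using (_∘_)
open import Relation.Binary.PropositionalEquality using (sym; trans; cong; subst)

p∸5+p∸2≡2p∸7 : ∀ {p} → 4 < p → p ∸ 5 + (p ∸ 2) ≡ 2 * p ∸ 7
p∸5+p∸2≡2p∸7 (s≤s (s≤s (s≤s (s≤s (s≤s {n = q} z≤n))))) = sym (cong (_∸ 2) (regroup q))
  where
  regroup : ∀ q → q + (5 + q + 0) ≡ 2 + (q + (3 + q))
  regroup = solve-∀

corollary3p1 : (p : ℕ) → .{{_ : NonZero p}} → Prime p → 3 < p →
    (N : ℕ) → N % p ≢ 0 →
      (N % p ≡ 1 → Fp.cardS p N ≡ p ∸ 5)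
      × (N % p ≡ 4 % p → Fp.cardS p N ≡ 2 * p ∸ 7)
      × (Fp.IsNonzeroSquare p N → N % p ≢ 1 → N % p ≢ 4 % p → Fp.cardS p N ≡ p ∸ 7)
      × (¬ Fp.IsNonzeroSquare p N → Fp.cardS p N ≡ p ∸ 3)
corollary3p1 p pr p>3 N N≢0 = when-N≡1 , when-N≡4 , when-square , NonSquare.count
  where
  open Congruence p pr
  open Fibers p pr p>3 N N≢0 using (n)
  open Cases p pr p>3 N N≢0
  1%p≡1 : 1 % p ≡ 1
  1%p≡1 = m<n⇒m%n≡m ⦃ p-nonZero ⦄ (<-trans (s≤s (s≤s z≤n)) p>3)
  -- p ≠ 4, as 4 ≉ 0 in F_p
  4<p : 4 < p
  4<p = ≤∧≢⇒< p>3 (λ 4≡p → 4≉0 (subst (λ t → + t ≈ 0ℤ) (sym 4≡p) P≈0))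
  when-N≡1 : N % p ≡ 1 → Fp.cardS p N ≡ p ∸ 5
  when-N≡1 N≡1 = One.count (%≡⇒≈ (trans N≡1 (sym 1%p≡1)))
  when-N≡4 : N % p ≡ 4 % p → Fp.cardS p N ≡ 2 * p ∸ 7
  when-N≡4 N≡4 = trans (Four.count (%≡⇒≈ N≡4)) (p∸5+p∸2≡2p∸7 4<p)
  when-square : Fp.IsNonzeroSquare p N → N % p ≢ 1 → N % p ≢ 4 % p → Fp.cardS p N ≡ p ∸ 7
  when-square (_ , s , s²≡N) N≢1 N≢4 =
    Square.Generic.count (+ toℕ s) S²≈n (λ n≈1 → N≢1 (trans (≈⇒%≡ n≈1) 1%p≡1)) (N≢4 ∘ ≈⇒%≡)
    where
    S²≈n : + toℕ s ℤ.* + toℕ s ≈ n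
    S²≈n = ≈-trans (≈-sym (⊗-≈ (toℕ s) (toℕ s))) (≈-trans (≡⇒≈ (cong +_ s²≡N)) (%-≈ N))
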